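{- For all integers $k\ge0$, $$\frac{G^P_{k_d}(q;a,b,c,d)}{1-bq^{k+1}}=H_k(q;a,b,c,d).$$
   Context: A coloured integer $m_x$ is a positive integer $m$ with colour $x\in\{a,b,c,d\}$, totally ordered by $1_a<1_b<1_c<1_d<2_a<2_b<\cdots$. Let $\mathcal{P}$ be the set of finite non-increasing (in this order, possibly empty) sequences of coloured positive integers such that consecutive parts $m_x$ (larger) and $m'_y$ (next) satisfy $m-m'\ge P(x,y)$, where $P(a,a)=2,P(a,b)=1,P(a,c)=2,P(a,d)=2$; $P(b,a)=1,P(b,b)=0,P(b,c)=1,P(b,d)=1$; $P(c,a)=0,P(c,b)=1,P(c,c)=0,P(c,d)=2$; $P(d,a)=0,P(d,b)=1,P(d,c)=0,P(d,d)=2$. $G^P_{k_d}(q;a,b,c,d)=\sum_\lambda q^{|\lambda|}a^{\#_a}b^{\#_b}c^{\#_c}d^{\#_d}$ over $\lambda\in\mathcal{P}$ whose parts all have value at most $k$ ($|\lambda|$ = sum of values, $\#_x$ = number of parts of colour $x$); so $G^P_{0_d}=1$. The sequence $(H_k(q;a,b,c,d))_{k\ge-3}$ is defined by $H_{ -1}=1$, $H_{ -2}=0$, $H_{ -3}=\frac{(b-1)cq}{ad}$ and, for $k\ge0$, $$(1-cq^k)(1-bq^{k+1})H_k=(1-bcq^{2k})H_{k-1}+(aq^k+dq^k+adq^{2k})H_{k-2}+adq^{2k-1}H_{k-3}.$$ -}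

module Defs where

open import Level using (Level; _⊔_) renaming (suc to lsuc)
open import Algebra.Bundles using (CommutativeRing)
open import Data.Nat as ℕ using (ℕ; zero; suc; _∸_; _≤_; _<_; _≟_; _≤?_; _<?_)
open import Data.Bool using (if_then_else_)
open import Data.Product using (_×_; _,_; proj₁; proj₂)
open import Data.Sum using (_⊎_)
open import Data.Nat.ListAction using (sum)
open import Data.List using (List; []; _∷_; map; concatMap; filter; foldr; applyUpTo; upTo; cartesianProduct)
open import Data.List.Relation.Unary.All using (All; all?)
open import Data.List.Relation.Unary.Linked using (Linked; linked?)
open import Relation.Binary.PropositionalEquality using (_≡_)
open import Relation.Nullary using (¬_; Dec)
open import Relation.Nullary.Decidable using (⌊_⌋; _×-dec_; _⊎-dec_)

record Field (c ℓ : Level) : Set (lsuc (c ⊔ ℓ)) where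
  field
    commutativeRing : CommutativeRing c ℓ
  open CommutativeRing commutativeRing public
  field
    0≉1     : ¬ (0# ≈ 1#)
    inv     : (x : Carrier) → ¬ (x ≈ 0#) → Carrier
    inv-law : (x : Carrier) (p : ¬ (x ≈ 0#)) → x * inv x p ≈ 1#

data Colour : Set where
  ca cb cc cd : Colour

rank : Colour → ℕ
rank ca = 0
rank cb = 1
rank cc = 2
rank cd = 3

-- coloured integer: (value m , colour x)
Part : Set
Part = ℕ × Colour

_≤ₚ_ : Part → Part → Set
(m′ , y) ≤ₚ (m , x) = (m′ < m) ⊎ ((m′ ≡ m) × (rank y ≤ rank x))

Pm : Colour → Colour → ℕ
Pm ca ca = 2
Pm ca cb = 1
Pm ca cc = 2
Pm ca cd = 2
Pm cb ca = 1
Pm cb cb = 0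
Pm cb cc = 1
Pm cb cd = 1
Pm cc ca = 0
Pm cc cb = 1
Pm cc cc = 0
Pm cc cd = 2
Pm cd ca = 0
Pm cd cb = 1
Pm cd cc = 0
Pm cd cd = 2

-- consecutive parts m_x (larger, first) and m′_y (next):
-- m′_y ≤ m_x in the order, and m - m′ ≥ P(x,y)
Adj : Part → Part → Set
Adj (m , x) (m′ , y) = ((m′ , y) ≤ₚ (m , x)) × (Pm x y ℕ.+ m′ ≤ m)

Positive : Part → Set
Positive (m , x) = 1 ≤ m

InP : List Part → Set
InP λs = All Positive λs × Linked Adj λs

value : Part → ℕ
value = proj₁

size : List Part → ℕ
size λs = sum (map value λs)

GSet : ℕ → ℕ → List Part → Set
GSet k n λs = InP λs × All (λ p → value p ≤ k) λs × (size λs ≡ n)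

≤ₚ? : (p q : Part) → Dec (p ≤ₚ q)
≤ₚ? (m′ , y) (m , x) = (m′ <? m) ⊎-dec ((m′ ≟ m) ×-dec (rank y ≤? rank x))

Adj? : (p q : Part) → Dec (Adj p q)
Adj? (m , x) (m′ , y) = ≤ₚ? (m′ , y) (m , x) ×-dec (Pm x y ℕ.+ m′ ≤? m)

GSet? : (k n : ℕ) (λs : List Part) → Dec (GSet k n λs)
GSet? k n λs =
  (all? (λ p → 1 ≤? proj₁ p) λs ×-dec linked? Adj? λs)
  ×-dec all? (λ p → value p ≤? k) λs ×-dec (size λs ≟ n)

colours : List Colour
colours = ca ∷ cb ∷ cc ∷ cd ∷ []

alphabet : ℕ → List Part
alphabet k = cartesianProduct (applyUpTo suc k) colours

listsOfLength : {A : Set} → List A → ℕ → List (List A)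
listsOfLength xs zero    = [] ∷ []
listsOfLength xs (suc l) = concatMap (λ x → map (x ∷_) (listsOfLength xs l)) xs

candidates : ℕ → ℕ → List (List Part)
candidates k n = concatMap (listsOfLength (alphabet k)) (upTo (suc n))

-- the coloured partitions counted by the coefficient of q^n in G^P_{k_d}
GPartitions : ℕ → ℕ → List (List Part)
GPartitions k n = filter (GSet? k n) (candidates k n)

module Series {c ℓ : Level} (F : Field c ℓ) where
  open Field F using (Carrier; _≈_; _+_; _*_; -_; _-_; 0#; 1#; inv)

  pow : Carrier → ℕ → Carrier
  pow x zero    = 1#
  pow x (suc j) = x * pow x j

  sumTo : (ℕ → Carrier) → ℕ → Carrier
  sumTo f zero    = f zero
  sumTo f (suc n) = sumTo f n + f (suc n)

  -- power series: n ↦ coefficient of q^n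
  PS : Set c
  PS = ℕ → Carrier

  const : Carrier → PS
  const x zero    = x
  const x (suc n) = 0#

  _⊕_ : PS → PS → PS
  (f ⊕ g) n = f n + g n

  _⊗_ : PS → PS → PS
  (f ⊗ g) n = sumTo (λ i → f i * g (n ∸ i)) n

  infixl 6 _⊕_
  infixl 7 _⊗_

  mulq : ℕ → PS → PS
  mulq zero    f n       = f n
  mulq (suc m) f zero    = 0#
  mulq (suc m) f (suc n) = mulq m f n

  -- multiplication by q^{-1} (used only on a series with zero constant term)
  divq : PS → PS
  divq f n = f (suc n)

  -- 1/(1 - x q^m) = Σ_j x^j q^{m j}   (m ≥ 1)
  inv1m : Carrier → ℕ → PS
  inv1m x m n = sumTo (λ j → if ⌊ m ℕ.* j ≟ n ⌋ then pow x j else 0#) n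

  module Vars (a b c d : Carrier) where
    var : Colour → Carrier
    var ca = a
    var cb = b
    var cc = c
    var cd = d

    weight : List Part → Carrier
    weight λs = foldr (λ p w → var (proj₂ p) * w) 1# λs

    G : ℕ → PS
    G k n = foldr (λ λs s → weight λs + s) 0# (GPartitions k n)

    -- H_k, given a ≠ 0, d ≠ 0, 1 - c ≠ 0 (needed to divide)
    module HDef (a≉0 : ¬ (a ≈ 0#)) (d≉0 : ¬ (d ≈ 0#)) (1-c≉0 : ¬ (1# - c ≈ 0#)) where
      -- H′ j = H_{j-3}
      H′ : ℕ → PS
      H′ zero = mulq 1 (const ((b - 1#) * c * inv a a≉0 * inv d d≉0))
      H′ (suc zero) = const 0#
      H′ (suc (suc zero)) = const 1#
      -- H_0 : (1 - c)(1 - b q) H_0 = (1 - b c) H_{-1} + (a + d + a d) H_{-2} + a d q^{-1} H_{-3}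
      H′ (suc (suc (suc zero))) =
        const (inv (1# - c) 1-c≉0) ⊗ inv1m b 1 ⊗
          ( const (1# - b * c) ⊗ H′ 2
          ⊕ const (a + d + a * d) ⊗ H′ 1
          ⊕ const (a * d) ⊗ divq (H′ 0))
      -- H_k, k = suc k′ ≥ 1 :
      -- (1 - c q^k)(1 - b q^{k+1}) H_k
      --   = (1 - b c q^{2k}) H_{k-1} + (a q^k + d q^k + a d q^{2k}) H_{k-2} + a d q^{2k-1} H_{k-3}
      H′ (suc (suc (suc (suc k′)))) =
        inv1m c k ⊗ inv1m b (suc k) ⊗
          ( (const 1# ⊕ mulq (2 ℕ.* k) (const (- (b * c)))) ⊗ H′ (suc (suc (suc k′)))
          ⊕ (mulq k (const (a + d)) ⊕ mulq (2 ℕ.* k) (const (a * d))) ⊗ H′ (suc (suc k′))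
          ⊕ mulq (2 ℕ.* k ∸ 1) (const (a * d)) ⊗ H′ (suc k′))
        where
          k : ℕ
          k = suc k′

      H : ℕ → PS
      H k = H′ (3 ℕ.+ k)

-- Classify the partitions by their largest part m_x.  It contributes x q^m times the
-- generating function of the partitions that may follow m_x, which by the difference
-- conditions is G_{m−2} plus the terms of those beginning with a part of size m − 1 or m.
-- With Ĝ_k = G_k / (1 − b q^{k+1}) and A_k the series of partitions that may follow
-- k_c (equivalently k_d), this yields
--   Ĝ_k = Ĝ_{k−1} + a q^k Ĝ_{k−2} + (c + d) q^k A_k + b q^{k+1} Ĝ_k,
--   A_{k+1} + d q^k A_k = G_k + a q^{k+1} Ĝ_{k−1} + c q^{k+1} A_{k+1}.
-- Eliminating A_k gives the recurrence defining H_k, and the initial values agree.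

module Submission where

open import Defs
open import Level using (Level; _⊔_)
open import Algebra.Bundles using (CommutativeRing; RawRing)
open import Data.Nat as ℕ using (ℕ; zero; suc; _∸_; _≤_; _<_; z≤n; s≤s)
import Data.Nat.Properties as ℕ
open import Data.Product using (_×_; _,_; proj₁; proj₂)
open import Data.Sum using (inj₁; inj₂)
import Data.Product.Properties as Product
open import Data.List using (List; []; _∷_; _++_; map; concatMap; foldr; filter; applyUpTo; upTo; cartesianProduct)
import Data.List.Properties as List
open import Data.Maybe using (Maybe; just; nothing)
open import Relation.Binary.PropositionalEquality as ≡ using (_≡_; _≢_)
open import Relation.Nullary using (¬_; Dec; yes; no; contradiction)
open import Relation.Nullary.Decidable using (⌊_⌋; _×-dec_)
open import Data.Unit using (⊤; tt)
open import Data.List.Relation.Unary.Linked as Linked using (Linked; []; [-]; _∷_; linked?)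
open import Data.List.Relation.Unary.All as All using (All; []; _∷_)
open import Data.Bool using (if_then_else_)

-- Ring solver with integer coefficients for an arbitrary commutative ring

-- Normal forms are compared syntactically, so coefficients must be canonical:
-- the integer p − n is represented by the pair (p , n) with p = 0 or n = 0.
Coefficient : Set
Coefficient = ℕ × ℕ

normalise : ℕ → ℕ → Coefficient
normalise p n = (p ∸ n , n ∸ p)

coefficientRing : RawRing _ _
coefficientRing = record
  { Carrier = Coefficient
  ; _≈_     = _≡_
  ; _+_     = λ (p , n) (p′ , n′) → normalise (p ℕ.+ p′) (n ℕ.+ n′)
  ; _*_     = λ (p , n) (p′ , n′) → normalise (p ℕ.* p′ ℕ.+ n ℕ.* n′) (p ℕ.* n′ ℕ.+ n ℕ.* p′)
  ; -_      = λ (p , n) → (n , p)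
  ; 0#      = (0 , 0)
  ; 1#      = (1 , 0)
  }

m∸n+n≡m+[n∸m] : ∀ m n → m ∸ n ℕ.+ n ≡ m ℕ.+ (n ∸ m)
m∸n+n≡m+[n∸m] zero    zero    = ≡.refl
m∸n+n≡m+[n∸m] zero    (suc n) = ≡.refl
m∸n+n≡m+[n∸m] (suc m) zero    = ≡.refl
m∸n+n≡m+[n∸m] (suc m) (suc n) = ≡.trans (ℕ.+-suc (m ∸ n) n) (≡.cong suc (m∸n+n≡m+[n∸m] m n))

module IntegerSolver {r₁ r₂} (R : CommutativeRing r₁ r₂) where
  open CommutativeRing R
  open import Algebra.Properties.Ring ring using (-‿distribˡ-*; -‿distribʳ-*; -‿involutive; -0#≈0#)
  open import Algebra.Properties.AbelianGroup +-abelianGroup using (⁻¹-∙-comm)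
  open import Algebra.Properties.CommutativeSemigroup +-commutativeSemigroup using () renaming (interchange to +-interchange)
  open import Algebra.Properties.Semiring.Mult.TCOptimised semiring using (×-homo-+; ×1-homo-*) renaming (_×_ to _×′_)
  open import Algebra.Solver.Ring.AlmostCommutativeRing using (fromCommutativeRing; _-Raw-AlmostCommutative⟶_)
  import Algebra.Solver.Ring.NaturalCoefficients.Default commutativeSemiring as ℕ-Solver
  open import Relation.Binary.Reasoning.Setoid setoid

  -- By cases, so that ⟦ 0 , 0 ⟧ᶜ and ⟦ 1 , 0 ⟧ᶜ are 0# and 1# definitionally.
  ⟦_⟧ᶜ : Coefficient → Carrier
  ⟦ p , zero  ⟧ᶜ = p ×′ 1#
  ⟦ p , suc n ⟧ᶜ = p ×′ 1# - suc n ×′ 1#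

  ⟦⟧ᶜ-difference : ∀ p n → ⟦ p , n ⟧ᶜ ≈ p ×′ 1# - n ×′ 1#
  ⟦⟧ᶜ-difference p zero    = sym (trans (+-congˡ -0#≈0#) (+-identityʳ _))
  ⟦⟧ᶜ-difference p (suc n) = refl

  -‿+-distrib : ∀ x y → - (x + y) ≈ - x + - y
  -‿+-distrib x y = sym (⁻¹-∙-comm x y)

  -‿*-cancel : ∀ x y → - x * - y ≈ x * y
  -‿*-cancel x y = trans (sym (-‿distribˡ-* x (- y))) (trans (-‿cong (sym (-‿distribʳ-* x y))) (-‿involutive (x * y)))

  difference-cong : ∀ {a b c d} → a + d ≈ c + b → a - b ≈ c - d
  difference-cong {a} {b} {c} {d} eq = begin
    a - b                 ≈⟨ sym (+-identityʳ _) ⟩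
    (a - b) + 0#          ≈⟨ +-congˡ (sym (-‿inverseʳ d)) ⟩
    (a - b) + (d - d)     ≈⟨ +-interchange a (- b) d (- d) ⟩
    (a + d) + (- b - d)   ≈⟨ +-congʳ eq ⟩
    (c + b) + (- b - d)   ≈⟨ ℕ-Solver.solve 4 (λ c b b′ d′ → (c :+ b) :+ (b′ :+ d′) := c :+ d′ :+ (b :+ b′))
                                             refl c b (- b) (- d) ⟩
    (c - d) + (b - b)     ≈⟨ +-congˡ (-‿inverseʳ b) ⟩
    (c - d) + 0#          ≈⟨ +-identityʳ _ ⟩
    c - d                 ∎
    where open ℕ-Solver using (_:+_; _:=_)

  ⟦normalise⟧ᶜ : ∀ p n → ⟦ normalise p n ⟧ᶜ ≈ p ×′ 1# - n ×′ 1#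
  ⟦normalise⟧ᶜ p n = trans (⟦⟧ᶜ-difference (p ∸ n) (n ∸ p)) (difference-cong (begin
    (p ∸ n) ×′ 1# + n ×′ 1#   ≈⟨ ×-homo-+ 1# (p ∸ n) n ⟨
    (p ∸ n ℕ.+ n) ×′ 1#       ≡⟨ ≡.cong (_×′ 1#) (m∸n+n≡m+[n∸m] p n) ⟩
    (p ℕ.+ (n ∸ p)) ×′ 1#     ≈⟨ ×-homo-+ 1# p (n ∸ p) ⟩
    p ×′ 1# + (n ∸ p) ×′ 1#   ∎))

  +-homo : ∀ x y → ⟦ RawRing._+_ coefficientRing x y ⟧ᶜ ≈ ⟦ x ⟧ᶜ + ⟦ y ⟧ᶜ
  +-homo (p , n) (p′ , n′) = begin
    ⟦ normalise (p ℕ.+ p′) (n ℕ.+ n′) ⟧ᶜ   ≈⟨ ⟦normalise⟧ᶜ (p ℕ.+ p′) (n ℕ.+ n′) ⟩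
    (p ℕ.+ p′) ×′ 1# - (n ℕ.+ n′) ×′ 1#
      ≈⟨ +-cong (×-homo-+ 1# p p′) (trans (-‿cong (×-homo-+ 1# n n′)) (-‿+-distrib N N′)) ⟩
    (P + P′) + (- N + - N′)               ≈⟨ +-interchange P P′ (- N) (- N′) ⟩
    (P - N) + (P′ - N′)                   ≈⟨ +-cong (⟦⟧ᶜ-difference p n) (⟦⟧ᶜ-difference p′ n′) ⟨
    ⟦ p , n ⟧ᶜ + ⟦ p′ , n′ ⟧ᶜ             ∎
    where P = p ×′ 1#; N = n ×′ 1#; P′ = p′ ×′ 1#; N′ = n′ ×′ 1#

  *-homo : ∀ x y → ⟦ RawRing._*_ coefficientRing x y ⟧ᶜ ≈ ⟦ x ⟧ᶜ * ⟦ y ⟧ᶜ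
  *-homo (p , n) (p′ , n′) = begin
    ⟦ normalise (p ℕ.* p′ ℕ.+ n ℕ.* n′) (p ℕ.* n′ ℕ.+ n ℕ.* p′) ⟧ᶜ
      ≈⟨ ⟦normalise⟧ᶜ (p ℕ.* p′ ℕ.+ n ℕ.* n′) (p ℕ.* n′ ℕ.+ n ℕ.* p′) ⟩
    (p ℕ.* p′ ℕ.+ n ℕ.* n′) ×′ 1# - (p ℕ.* n′ ℕ.+ n ℕ.* p′) ×′ 1#
      ≈⟨ +-cong (trans (×-homo-+ 1# (p ℕ.* p′) (n ℕ.* n′)) (+-cong (×1-homo-* p p′) (×1-homo-* n n′)))
                (-‿cong (trans (×-homo-+ 1# (p ℕ.* n′) (n ℕ.* p′)) (+-cong (×1-homo-* p n′) (×1-homo-* n p′)))) ⟩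
    (P * P′ + N * N′) - (P * N′ + N * P′)
      ≈⟨ +-cong (+-congˡ (sym (-‿*-cancel N N′)))
                (trans (-‿+-distrib _ _) (+-cong (-‿distribʳ-* P N′) (-‿distribˡ-* N P′))) ⟩
    (P * P′ + - N * - N′) + (P * - N′ + - N * P′)
      ≈⟨ ℕ-Solver.solve 4 (λ a b c d → (a :* c :+ b :* d) :+ (a :* d :+ b :* c) := (a :+ b) :* (c :+ d))
                          refl P (- N) P′ (- N′) ⟩
    (P - N) * (P′ - N′)
      ≈⟨ *-cong (⟦⟧ᶜ-difference p n) (⟦⟧ᶜ-difference p′ n′) ⟨
    ⟦ p , n ⟧ᶜ * ⟦ p′ , n′ ⟧ᶜ ∎
    where
    open ℕ-Solver using (_:+_; _:*_; _:=_)
    P = p ×′ 1#; N = n ×′ 1#; P′ = p′ ×′ 1#; N′ = n′ ×′ 1#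

  -‿homo : ∀ x → ⟦ RawRing.-_ coefficientRing x ⟧ᶜ ≈ - ⟦ x ⟧ᶜ
  -‿homo (p , n) = begin
    ⟦ n , p ⟧ᶜ                  ≈⟨ ⟦⟧ᶜ-difference n p ⟩
    n ×′ 1# - p ×′ 1#           ≈⟨ +-comm _ _ ⟩
    - (p ×′ 1#) + n ×′ 1#       ≈⟨ +-congˡ (-‿involutive _) ⟨
    - (p ×′ 1#) - - (n ×′ 1#)   ≈⟨ -‿+-distrib _ _ ⟨
    - (p ×′ 1# - n ×′ 1#)       ≈⟨ -‿cong (⟦⟧ᶜ-difference p n) ⟨
    - ⟦ p , n ⟧ᶜ                ∎

  homomorphism : coefficientRing -Raw-AlmostCommutative⟶ fromCommutativeRing R
  homomorphism = record
    { ⟦_⟧    = ⟦_⟧ᶜ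
    ; +-homo = +-homo
    ; *-homo = *-homo
    ; -‿homo = -‿homo
    ; 0-homo = refl
    ; 1-homo = refl
    }

  coefficient≟ : ∀ x y → Maybe (⟦ x ⟧ᶜ ≈ ⟦ y ⟧ᶜ)
  coefficient≟ x y with Product.≡-dec ℕ._≟_ ℕ._≟_ x y
  ... | yes ≡.refl = just refl
  ... | no _       = nothing

  open import Algebra.Solver.Ring coefficientRing (fromCommutativeRing R) homomorphism coefficient≟ public
    using (Polynomial; con; _:+_; _:*_; :-_; _:-_; _:=_; solve)

  :0 :1 : ∀ {n} → Polynomial n
  :0 = con (0 , 0)
  :1 = con (1 , 0)

  -- To derive x ≈ y from hypotheses uᵢ ≈ vᵢ it suffices to solve x ≈ y + Σᵢ kᵢ (uᵢ − vᵢ).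
  data Weighted : Set (r₁ ⊔ r₂) where
    ⟨_⟩ : ∀ {u v} → u ≈ v → Weighted
    _·_ : ∀ (k : Carrier) {u v} → u ≈ v → Weighted

  infix 6 _·_

  term : Weighted → Carrier
  term (⟨_⟩ {u} {v} _)   = u - v
  term (_·_ k {u} {v} _) = k * (u - v)

  combination : List Weighted → Carrier
  combination []       = 0#
  combination (w ∷ []) = term w
  combination (w ∷ ws) = term w + combination ws

  term≈0 : ∀ w → term w ≈ 0#
  term≈0 (⟨_⟩ {v = v} eq)   = trans (+-congʳ eq) (-‿inverseʳ v)
  term≈0 (_·_ k {v = v} eq) = trans (*-congˡ (trans (+-congʳ eq) (-‿inverseʳ v))) (zeroʳ k)

  combination≈0 : ∀ ws → combination ws ≈ 0#
  combination≈0 []            = refl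
  combination≈0 (w ∷ [])      = term≈0 w
  combination≈0 (w ∷ w′ ∷ ws) = trans (+-cong (term≈0 w) (combination≈0 (w′ ∷ ws))) (+-identityʳ 0#)

  linear-combination : ∀ {x y} ws → x ≈ y + combination ws → x ≈ y
  linear-combination {y = y} ws eq = trans eq (trans (+-congˡ (combination≈0 ws)) (+-identityʳ y))

module PowerSeries {c ℓ : Level} (F : Field c ℓ) where
  open Field F hiding (zero)
  open Series F
  open import Algebra.Properties.CommutativeSemigroup +-commutativeSemigroup using () renaming (interchange to +-interchange)
  open import Relation.Binary.Reasoning.Setoid setoid

  sumTo-congᵇ : ∀ {f g : ℕ → Carrier} n → (∀ i → i ≤ n → f i ≈ g i) → sumTo f n ≈ sumTo g n
  sumTo-congᵇ zero    eq = eq 0 z≤n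
  sumTo-congᵇ (suc n) eq = +-cong (sumTo-congᵇ n (λ i i≤n → eq i (ℕ.m≤n⇒m≤1+n i≤n))) (eq (suc n) ℕ.≤-refl)

  sumTo-cong : ∀ {f g : ℕ → Carrier} n → (∀ i → f i ≈ g i) → sumTo f n ≈ sumTo g n
  sumTo-cong n eq = sumTo-congᵇ n (λ i _ → eq i)

  sumTo-zero : ∀ {f : ℕ → Carrier} n → (∀ i → i ≤ n → f i ≈ 0#) → sumTo f n ≈ 0#
  sumTo-zero zero    eq = eq 0 z≤n
  sumTo-zero (suc n) eq =
    trans (+-cong (sumTo-zero n (λ i i≤n → eq i (ℕ.m≤n⇒m≤1+n i≤n))) (eq (suc n) ℕ.≤-refl)) (+-identityʳ 0#)

  sumTo-+ : ∀ (f g : ℕ → Carrier) n → sumTo (λ i → f i + g i) n ≈ sumTo f n + sumTo g n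
  sumTo-+ f g zero    = refl
  sumTo-+ f g (suc n) = trans (+-congʳ (sumTo-+ f g n)) (+-interchange (sumTo f n) (sumTo g n) (f (suc n)) (g (suc n)))

  *-distribˡ-sumTo : ∀ x (f : ℕ → Carrier) n → x * sumTo f n ≈ sumTo (λ i → x * f i) n
  *-distribˡ-sumTo x f zero    = refl
  *-distribˡ-sumTo x f (suc n) = trans (distribˡ x (sumTo f n) (f (suc n))) (+-congʳ (*-distribˡ-sumTo x f n))

  sumTo-suc : ∀ (f : ℕ → Carrier) n → sumTo f (suc n) ≈ f 0 + sumTo (λ i → f (suc i)) n
  sumTo-suc f zero    = refl
  sumTo-suc f (suc n) = trans (+-congʳ (sumTo-suc f n)) (+-assoc _ _ _)

  sumTo-reverse : ∀ (f : ℕ → Carrier) n → sumTo f n ≈ sumTo (λ i → f (n ∸ i)) n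
  sumTo-reverse f zero    = refl
  sumTo-reverse f (suc n) = begin
    sumTo f n + f (suc n)                  ≈⟨ +-congʳ (sumTo-reverse f n) ⟩
    sumTo (λ i → f (n ∸ i)) n + f (suc n)  ≈⟨ +-comm _ _ ⟩
    f (suc n) + sumTo (λ i → f (n ∸ i)) n  ≈⟨ sym (sumTo-suc (λ i → f (suc n ∸ i)) n) ⟩
    sumTo (λ i → f (suc n ∸ i)) (suc n)    ∎

  sumTo-truncate : ∀ (f : ℕ → Carrier) {m n} → m ≤ n → (∀ i → m < i → i ≤ n → f i ≈ 0#) → sumTo f n ≈ sumTo f m
  sumTo-truncate f {m} {n} m≤n eq with ℕ.m≤n⇒m<n∨m≡n m≤n
  ... | inj₂ ≡.refl = refl
  sumTo-truncate f {m} {suc n} _ eq | inj₁ (s≤s m≤n) =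
    trans (+-cong (sumTo-truncate f m≤n (λ i m<i i≤n → eq i m<i (ℕ.m≤n⇒m≤1+n i≤n))) (eq (suc n) (s≤s m≤n) ℕ.≤-refl))
          (+-identityʳ _)

  infix 4 _≋_
  _≋_ : PS → PS → Set ℓ
  f ≋ g = ∀ n → f n ≈ g n

  ⊖_ : PS → PS
  (⊖ f) n = - f n

  _•_ : Carrier → PS → PS
  (x • f) n = x * f n

  const-0# : ∀ n → const 0# n ≈ 0#
  const-0# zero    = refl
  const-0# (suc n) = refl

  ⊗-suc : ∀ f g n → (f ⊗ g) (suc n) ≈ f 0 * g (suc n) + (divq f ⊗ g) n
  ⊗-suc f g n = sumTo-suc (λ i → f i * g (suc n ∸ i)) n

  ⊗-congˡ : ∀ {f f′} g → f ≋ f′ → f ⊗ g ≋ f′ ⊗ g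
  ⊗-congˡ g eq n = sumTo-cong n (λ i → *-congʳ (eq i))

  ⊗-congʳ : ∀ f {g g′} → g ≋ g′ → f ⊗ g ≋ f ⊗ g′
  ⊗-congʳ f eq n = sumTo-cong n (λ i → *-congˡ (eq (n ∸ i)))

  ⊗-distribʳ : ∀ f g h → (f ⊕ g) ⊗ h ≋ f ⊗ h ⊕ g ⊗ h
  ⊗-distribʳ f g h n = trans (sumTo-cong n (λ i → distribʳ (h (n ∸ i)) (f i) (g i))) (sumTo-+ _ _ n)

  •-⊗ : ∀ x f g → (x • f) ⊗ g ≋ x • (f ⊗ g)
  •-⊗ x f g n = trans (sumTo-cong n (λ i → *-assoc x (f i) (g (n ∸ i)))) (sym (*-distribˡ-sumTo x _ n))

  ⊗-zeroˡ : ∀ {f} g → (∀ i → f i ≈ 0#) → ∀ n → (f ⊗ g) n ≈ 0#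
  ⊗-zeroˡ g eq n = sumTo-zero n (λ i _ → trans (*-congʳ (eq i)) (zeroˡ _))

  ⊗-assoc : ∀ f g h → (f ⊗ g) ⊗ h ≋ f ⊗ (g ⊗ h)
  ⊗-assoc f g h zero    = *-assoc (f 0) (g 0) (h 0)
  ⊗-assoc f g h (suc n) = begin
    ((f ⊗ g) ⊗ h) (suc n)                                           ≈⟨ ⊗-suc (f ⊗ g) h n ⟩
    f₀ * g₀ * h (suc n) + (divq (f ⊗ g) ⊗ h) n                      ≈⟨ +-congˡ (⊗-congˡ h (⊗-suc f g) n) ⟩
    f₀ * g₀ * h (suc n) + ((f₀ • divq g ⊕ divq f ⊗ g) ⊗ h) n        ≈⟨ +-congˡ (⊗-distribʳ _ _ h n) ⟩
    f₀ * g₀ * h (suc n) + (((f₀ • divq g) ⊗ h) n + ((divq f ⊗ g) ⊗ h) n)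
                                                                     ≈⟨ +-congˡ (+-cong (•-⊗ f₀ (divq g) h n) (⊗-assoc (divq f) g h n)) ⟩
    f₀ * g₀ * h (suc n) + (f₀ * (divq g ⊗ h) n + (divq f ⊗ (g ⊗ h)) n)
                                                                     ≈⟨ sym (+-assoc _ _ _) ⟩
    f₀ * g₀ * h (suc n) + f₀ * (divq g ⊗ h) n + (divq f ⊗ (g ⊗ h)) n ≈⟨ +-congʳ (+-congʳ (*-assoc f₀ g₀ (h (suc n)))) ⟩
    f₀ * (g₀ * h (suc n)) + f₀ * (divq g ⊗ h) n + (divq f ⊗ (g ⊗ h)) n
                                                                     ≈⟨ +-congʳ (sym (distribˡ f₀ _ _)) ⟩
    f₀ * (g₀ * h (suc n) + (divq g ⊗ h) n) + (divq f ⊗ (g ⊗ h)) n   ≈⟨ +-congʳ (*-congˡ (sym (⊗-suc g h n))) ⟩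
    f₀ * (g ⊗ h) (suc n) + (divq f ⊗ (g ⊗ h)) n                     ≈⟨ sym (⊗-suc f (g ⊗ h) n) ⟩
    (f ⊗ (g ⊗ h)) (suc n)                                           ∎
    where f₀ = f 0; g₀ = g 0

  ⊗-comm : ∀ f g → f ⊗ g ≋ g ⊗ f
  ⊗-comm f g n = trans (sumTo-reverse _ n) (sumTo-congᵇ n (λ i i≤n →
    trans (*-comm _ _) (*-congʳ (reflexive (≡.cong g (ℕ.m∸[m∸n]≡n i≤n))))))

  ⊗-identityˡ : ∀ f → const 1# ⊗ f ≋ f
  ⊗-identityˡ f zero    = *-identityˡ (f 0)
  ⊗-identityˡ f (suc n) = trans (⊗-suc (const 1#) f n)
    (trans (+-cong (*-identityˡ _) (⊗-zeroˡ f (λ _ → refl) n)) (+-identityʳ _))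

  powerSeriesRing : CommutativeRing c ℓ
  powerSeriesRing = record
    { Carrier = PS
    ; _≈_ = _≋_
    ; _+_ = _⊕_
    ; _*_ = _⊗_
    ; -_ = ⊖_
    ; 0# = const 0#
    ; 1# = const 1#
    ; isCommutativeRing = record
      { isRing = record
        { +-isAbelianGroup = record
          { isGroup = record
            { isMonoid = record
              { isSemigroup = record
                { isMagma = record
                  { isEquivalence = record
                    { refl  = λ n → refl
                    ; sym   = λ eq n → sym (eq n)
                    ; trans = λ eq eq′ n → trans (eq n) (eq′ n)
                    }
                  ; ∙-cong = λ eq eq′ n → +-cong (eq n) (eq′ n)
                  }
                ; assoc = λ f g h n → +-assoc (f n) (g n) (h n)
                }
              ; identity = (λ f n → trans (+-congʳ (const-0# n)) (+-identityˡ (f n)))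
                         , (λ f n → trans (+-congˡ (const-0# n)) (+-identityʳ (f n)))
              }
            ; inverse = (λ f n → trans (-‿inverseˡ (f n)) (sym (const-0# n)))
                      , (λ f n → trans (-‿inverseʳ (f n)) (sym (const-0# n)))
            ; ⁻¹-cong = λ eq n → -‿cong (eq n)
            }
          ; comm = λ f g n → +-comm (f n) (g n)
          }
        ; *-cong = λ {f} {f′} {g} eq eq′ n → trans (⊗-congˡ g eq n) (⊗-congʳ f′ eq′ n)
        ; *-assoc = ⊗-assoc
        ; *-identity = ⊗-identityˡ , (λ f n → trans (⊗-comm f (const 1#) n) (⊗-identityˡ f n))
        ; distrib = (λ f g h n → trans (⊗-comm f (g ⊕ h) n)
                                   (trans (⊗-distribʳ g h f n) (+-cong (⊗-comm g f n) (⊗-comm h f n))))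
                  , (λ f g h → ⊗-distribʳ g h f)
        }
      ; *-comm = ⊗-comm
      }
    }

  mulq-cong : ∀ m {f g} → f ≋ g → mulq m f ≋ mulq m g
  mulq-cong zero    eq n       = eq n
  mulq-cong (suc m) eq zero    = refl
  mulq-cong (suc m) eq (suc n) = mulq-cong m eq n

  mulq-≥ : ∀ m f {n} → m ≤ n → mulq m f n ≡ f (n ∸ m)
  mulq-≥ zero    f         _         = ≡.refl
  mulq-≥ (suc m) f {suc n} (s≤s m≤n) = mulq-≥ m f m≤n

  mulq-< : ∀ m f {n} → n < m → mulq m f n ≡ 0#
  mulq-< (suc m) f {zero}  _         = ≡.refl
  mulq-< (suc m) f {suc n} (s≤s n<m) = mulq-< m f n<m

  mulq-mulq : ∀ m m′ f n → mulq m (mulq m′ f) n ≡ mulq (m ℕ.+ m′) f n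
  mulq-mulq zero    m′ f n       = ≡.refl
  mulq-mulq (suc m) m′ f zero    = ≡.refl
  mulq-mulq (suc m) m′ f (suc n) = mulq-mulq m m′ f n

  mulq-⊗ : ∀ m f g → mulq m f ⊗ g ≋ mulq m (f ⊗ g)
  mulq-⊗ zero    f g n       = refl
  mulq-⊗ (suc m) f g zero    = zeroˡ _
  mulq-⊗ (suc m) f g (suc n) =
    trans (⊗-suc (mulq (suc m) f) g n) (trans (+-congʳ (zeroˡ _)) (trans (+-identityˡ _) (mulq-⊗ m f g n)))

  q^_ : ℕ → PS
  q^ m = mulq m (const 1#)

  mulq≋q^⊗ : ∀ m f → mulq m f ≋ q^ m ⊗ f
  mulq≋q^⊗ m f n = sym (trans (mulq-⊗ m (const 1#) f n) (mulq-cong m (⊗-identityˡ f) n))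

  q^-+ : ∀ m m′ → q^ (m ℕ.+ m′) ≋ q^ m ⊗ q^ m′
  q^-+ m m′ n = trans (reflexive (≡.sym (mulq-mulq m m′ (const 1#) n))) (mulq≋q^⊗ m (q^ m′) n)

  const-⊗ : ∀ x f → const x ⊗ f ≋ x • f
  const-⊗ x f zero    = refl
  const-⊗ x f (suc n) = trans (⊗-suc (const x) f n) (trans (+-congˡ (⊗-zeroˡ f (λ _ → refl) n)) (+-identityʳ _))

  const-cong : ∀ {x y} → x ≈ y → const x ≋ const y
  const-cong eq zero    = eq
  const-cong eq (suc n) = refl

  const-+ : ∀ x y → const (x + y) ≋ const x ⊕ const y
  const-+ x y zero    = refl
  const-+ x y (suc n) = sym (+-identityʳ 0#)

  const-* : ∀ x y → const (x * y) ≋ const x ⊗ const y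
  const-* x y zero    = refl
  const-* x y (suc n) = sym (trans (const-⊗ x (const y) (suc n)) (zeroʳ x))

  const-neg : ∀ x → const (- x) ≋ ⊖ const x
  const-neg x zero    = refl
  const-neg x (suc n) = sym (trans (sym (+-identityˡ (- 0#))) (-‿inverseʳ 0#))

  iverson : ∀ {p} {P : Set p} → Dec P → Carrier → Carrier
  iverson P? w = if ⌊ P? ⌋ then w else 0#

  iverson-yes : ∀ {p} {P : Set p} (P? : Dec P) {w} → P → iverson P? w ≈ w
  iverson-yes (yes _) _  = refl
  iverson-yes (no ¬p) p  = contradiction p ¬p

  iverson-no : ∀ {p} {P : Set p} (P? : Dec P) {w} → ¬ P → iverson P? w ≈ 0#
  iverson-no (yes p) ¬p = contradiction p ¬p
  iverson-no (no _)  _  = refl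

  iverson-cong : ∀ {p} {P : Set p} (P? : Dec P) {w w′} → w ≈ w′ → iverson P? w ≈ iverson P? w′
  iverson-cong (yes _) eq = eq
  iverson-cong (no _)  eq = refl

  iverson-zero : ∀ {p} {P : Set p} (P? : Dec P) {w} → w ≈ 0# → iverson P? w ≈ 0#
  iverson-zero (yes _) eq = eq
  iverson-zero (no _)  eq = refl

  iverson-⇔ : ∀ {p q} {P : Set p} {Q : Set q} (P? : Dec P) (Q? : Dec Q) {w} →
              (P → Q) → (Q → P) → iverson P? w ≈ iverson Q? w
  iverson-⇔ (yes p) Q? P→Q Q→P = sym (iverson-yes Q? (P→Q p))
  iverson-⇔ (no ¬p) Q? P→Q Q→P = sym (iverson-no Q? (λ q → ¬p (Q→P q)))

  *-iverson : ∀ {p} {P : Set p} (P? : Dec P) x w → x * iverson P? w ≈ iverson P? (x * w)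
  *-iverson (yes _) x w = refl
  *-iverson (no _)  x w = zeroʳ x

  inv1m-zero : ∀ x m → inv1m x (suc m) 0 ≈ 1#
  inv1m-zero x m = iverson-yes (suc m ℕ.* 0 ℕ.≟ 0) (ℕ.*-zeroʳ (suc m))

  inv1m-below : ∀ x m {n} → 0 < n → n < suc m → inv1m x (suc m) n ≈ 0#
  inv1m-below x m {n} 0<n n<1+m = sumTo-zero n (λ j _ → iverson-no (suc m ℕ.* j ℕ.≟ n) (multiple≢ j))
    where
    multiple≢ : ∀ j → suc m ℕ.* j ≢ n
    multiple≢ zero    eq = ℕ.<⇒≢ 0<n (≡.trans (≡.sym (ℕ.*-zeroʳ m)) eq)
    multiple≢ (suc j) eq = ℕ.<⇒≱ n<1+m (≡.subst (suc m ≤_) eq (ℕ.m≤m*n (suc m) (suc j)))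

  inv1m-step : ∀ x m n → inv1m x (suc m) (suc m ℕ.+ n) ≈ x * inv1m x (suc m) n
  inv1m-step x m n = begin
    inv1m x (suc m) (suc m ℕ.+ n)                                    ≈⟨ sumTo-suc _ (m ℕ.+ n) ⟩
    term (suc m ℕ.+ n) 0 + sumTo (λ j → term (suc m ℕ.+ n) (suc j)) (m ℕ.+ n)
                                                                      ≈⟨ +-cong (iverson-no (suc m ℕ.* 0 ℕ.≟ suc m ℕ.+ n) zero≢)
                                                                                (sumTo-cong (m ℕ.+ n) term-suc) ⟩
    0# + sumTo (λ j → x * term n j) (m ℕ.+ n)                        ≈⟨ +-identityˡ _ ⟩
    sumTo (λ j → x * term n j) (m ℕ.+ n)                             ≈⟨ sym (*-distribˡ-sumTo x _ (m ℕ.+ n)) ⟩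
    x * sumTo (term n) (m ℕ.+ n)                                     ≈⟨ *-congˡ (sumTo-truncate (term n) (ℕ.m≤n+m n m) vanishes) ⟩
    x * inv1m x (suc m) n                                            ∎
    where
    term : ℕ → ℕ → Carrier
    term n j = iverson (suc m ℕ.* j ℕ.≟ n) (pow x j)
    zero≢ : suc m ℕ.* 0 ≢ suc m ℕ.+ n
    zero≢ eq = ℕ.0≢1+n (≡.trans (≡.sym (ℕ.*-zeroʳ m)) eq)
    vanishes : ∀ j → n < j → j ≤ m ℕ.+ n → term n j ≈ 0#
    vanishes j n<j _ = iverson-no (suc m ℕ.* j ℕ.≟ n) (λ eq → ℕ.<⇒≱ n<j (≡.subst (j ≤_) eq (ℕ.m≤m+n j (m ℕ.* j))))
    term-suc : ∀ j → term (suc m ℕ.+ n) (suc j) ≈ x * term n j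
    term-suc j with suc m ℕ.* j ℕ.≟ n
    ... | yes eq = iverson-yes (suc m ℕ.* suc j ℕ.≟ suc m ℕ.+ n) (≡.trans (ℕ.*-suc (suc m) j) (≡.cong (suc m ℕ.+_) eq))
    ... | no ¬eq = trans (iverson-no (suc m ℕ.* suc j ℕ.≟ suc m ℕ.+ n)
                            (λ eq → ¬eq (ℕ.+-cancelˡ-≡ (suc m) _ _ (≡.trans (≡.sym (ℕ.*-suc (suc m) j)) eq))))
                         (sym (zeroʳ x))

  inv1m-geometric : ∀ x m → inv1m x (suc m) ≋ const 1# ⊕ (const x ⊗ q^ suc m) ⊗ inv1m x (suc m)
  inv1m-geometric x m n = sym (begin
    const 1# n + ((const x ⊗ q^ suc m) ⊗ I) n     ≈⟨ +-congˡ (⊗-assoc (const x) (q^ suc m) I n) ⟩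
    const 1# n + (const x ⊗ (q^ suc m ⊗ I)) n     ≈⟨ +-congˡ (const-⊗ x (q^ suc m ⊗ I) n) ⟩
    const 1# n + x * (q^ suc m ⊗ I) n             ≈⟨ +-congˡ (*-congˡ (sym (mulq≋q^⊗ (suc m) I n))) ⟩
    const 1# n + x * mulq (suc m) I n             ≈⟨ pointwise n ⟩
    I n                                           ∎)
    where
    I = inv1m x (suc m)
    pointwise : ∀ n → const 1# n + x * mulq (suc m) I n ≈ I n
    pointwise zero = trans (+-congˡ (zeroʳ x)) (trans (+-identityʳ _) (sym (inv1m-zero x m)))
    pointwise (suc n) with suc n ℕ.<? suc m
    ... | yes n<m = trans (+-congˡ (trans (*-congˡ (reflexive (mulq-< (suc m) I n<m))) (zeroʳ x)))
                          (trans (+-identityʳ 0#) (sym (inv1m-below x m (s≤s z≤n) n<m)))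
    ... | no n≮m  = begin
      0# + x * mulq (suc m) I (suc n)    ≈⟨ +-identityˡ _ ⟩
      x * mulq (suc m) I (suc n)         ≡⟨ ≡.cong (x *_) (mulq-≥ (suc m) I m≤n) ⟩
      x * I (suc n ∸ suc m)              ≈⟨ sym (inv1m-step x m (suc n ∸ suc m)) ⟩
      I (suc m ℕ.+ (suc n ∸ suc m))      ≡⟨ ≡.cong I (ℕ.m+[n∸m]≡n m≤n) ⟩
      I (suc n)                          ∎
      where m≤n = ℕ.≮⇒≥ n≮m

  inv1m-inverse : ∀ x m → inv1m x (suc m) ⊗ (const 1# ⊕ ⊖ (const x ⊗ q^ suc m)) ≋ const 1#
  inv1m-inverse x m = linear-combination (⟨ inv1m-geometric x m ⟩ ∷ [])
    (solve 3 (λ i x q → i :* (:1 :- x :* q) := :1 :+ (i :- (:1 :+ (x :* q) :* i)))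
           (λ _ → refl) (inv1m x (suc m)) (const x) (q^ suc m))
    where open IntegerSolver powerSeriesRing using (solve; _:+_; _:*_; _:-_; _:=_; :1; linear-combination; ⟨_⟩)

  mulq-const : ∀ m x → mulq m (const x) ≋ const x ⊗ q^ m
  mulq-const m x n = trans (mulq≋q^⊗ m (const x) n) (⊗-comm (q^ m) (const x) n)

  q^-double : ∀ k → q^ (2 ℕ.* k) ≋ q^ k ⊗ q^ k
  q^-double k n = trans (q^-+ k (k ℕ.+ 0) n) (reflexive (≡.cong (λ j → (q^ k ⊗ q^ j) n) (ℕ.+-identityʳ k)))

  q^-double-pred : ∀ k → q^ (2 ℕ.* suc k ∸ 1) ≋ q^ suc k ⊗ q^ k
  q^-double-pred k n = trans (q^-+ k (suc k ℕ.+ 0) n)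
    (trans (reflexive (≡.cong (λ j → (q^ k ⊗ q^ j) n) (ℕ.+-identityʳ (suc k)))) (⊗-comm (q^ k) (q^ suc k) n))

module Sums {c ℓ : Level} (F : Field c ℓ) where
  open Field F hiding (zero)
  open Series F
  open PowerSeries F
  open import Algebra.Properties.CommutativeSemigroup +-commutativeSemigroup using () renaming (interchange to +-interchange)
  open import Relation.Binary.Reasoning.Setoid setoid

  sumList : ∀ {A : Set} → (A → Carrier) → List A → Carrier
  sumList f = foldr (λ x s → f x + s) 0#

  sumList-cong : ∀ {A : Set} {f g : A → Carrier} xs → (∀ x → f x ≈ g x) → sumList f xs ≈ sumList g xs
  sumList-cong []       eq = refl
  sumList-cong (x ∷ xs) eq = +-cong (eq x) (sumList-cong xs eq)

  sumList-+ : ∀ {A : Set} (f g : A → Carrier) xs → sumList (λ x → f x + g x) xs ≈ sumList f xs + sumList g xs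
  sumList-+ f g []       = sym (+-identityʳ 0#)
  sumList-+ f g (x ∷ xs) = trans (+-congˡ (sumList-+ f g xs)) (+-interchange (f x) (g x) (sumList f xs) (sumList g xs))

  sumList-zero : ∀ {A : Set} {f : A → Carrier} xs → (∀ x → f x ≈ 0#) → sumList f xs ≈ 0#
  sumList-zero []       eq = refl
  sumList-zero (x ∷ xs) eq = trans (+-cong (eq x) (sumList-zero xs eq)) (+-identityʳ 0#)

  sumList-++ : ∀ {A : Set} (f : A → Carrier) xs ys → sumList f (xs ++ ys) ≈ sumList f xs + sumList f ys
  sumList-++ f []       ys = sym (+-identityˡ _)
  sumList-++ f (x ∷ xs) ys = trans (+-congˡ (sumList-++ f xs ys)) (sym (+-assoc _ _ _))

  sumList-map : ∀ {A B : Set} (f : B → Carrier) (g : A → B) xs → sumList f (map g xs) ≈ sumList (λ x → f (g x)) xs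
  sumList-map f g []       = refl
  sumList-map f g (x ∷ xs) = +-congˡ (sumList-map f g xs)

  sumList-concatMap : ∀ {A B : Set} (f : B → Carrier) (g : A → List B) xs →
                      sumList f (concatMap g xs) ≈ sumList (λ x → sumList f (g x)) xs
  sumList-concatMap f g []       = refl
  sumList-concatMap f g (x ∷ xs) = trans (sumList-++ f (g x) (concatMap g xs)) (+-congˡ (sumList-concatMap f g xs))

  *-distribˡ-sumList : ∀ {A : Set} x (f : A → Carrier) xs → x * sumList f xs ≈ sumList (λ y → x * f y) xs
  *-distribˡ-sumList x f []       = zeroʳ x
  *-distribˡ-sumList x f (y ∷ xs) = trans (distribˡ x _ _) (+-congˡ (*-distribˡ-sumList x f xs))

  sumList-filter : ∀ {A : Set} {p} {P : A → Set p} (P? : ∀ x → Dec (P x)) (f : A → Carrier) xs →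
                   sumList f (filter P? xs) ≈ sumList (λ x → iverson (P? x) (f x)) xs
  sumList-filter P? f []       = refl
  sumList-filter P? f (x ∷ xs) with P? x
  ... | yes _ = +-congˡ (sumList-filter P? f xs)
  ... | no  _ = trans (sumList-filter P? f xs) (sym (+-identityˡ _))

  sumList-applyUpTo : ∀ (f : ℕ → Carrier) (g : ℕ → ℕ) n → sumList f (applyUpTo g (suc n)) ≈ sumTo (λ i → f (g i)) n
  sumList-applyUpTo f g zero    = +-identityʳ _
  sumList-applyUpTo f g (suc n) = trans (+-congˡ (sumList-applyUpTo f (λ i → g (suc i)) n)) (sym (sumTo-suc (λ i → f (g i)) n))

  row : (Part → Carrier) → ℕ → Carrier
  row f m = sumList (λ x → f (m , x)) colours

  sumAlphabet : ℕ → (Part → Carrier) → Carrier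
  sumAlphabet zero    f = 0#
  sumAlphabet (suc k) f = sumAlphabet k f + row f (suc k)

  sumList-alphabet : ∀ (f : Part → Carrier) k → sumList f (alphabet k) ≈ sumAlphabet k f
  sumList-alphabet f k = trans (by-rows (applyUpTo suc k)) (rows k)
    where
    by-rows : ∀ ms → sumList f (cartesianProduct ms colours) ≈ sumList (row f) ms
    by-rows []       = refl
    by-rows (m ∷ ms) = trans (sumList-++ f (map (m ,_) colours) (cartesianProduct ms colours))
                             (+-cong (sumList-map f (m ,_) colours) (by-rows ms))
    rows : ∀ k → sumList (row f) (applyUpTo suc k) ≈ sumAlphabet k f
    rows zero    = refl
    rows (suc k) = begin
      sumList (row f) (applyUpTo suc (suc k))          ≡⟨ ≡.cong (sumList (row f)) (≡.sym (List.applyUpTo-∷ʳ suc k)) ⟩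
      sumList (row f) (applyUpTo suc k ++ suc k ∷ [])  ≈⟨ sumList-++ (row f) (applyUpTo suc k) (suc k ∷ []) ⟩
      sumList (row f) (applyUpTo suc k) + (row f (suc k) + 0#)  ≈⟨ +-cong (rows k) (+-identityʳ _) ⟩
      sumAlphabet (suc k) f                            ∎

  InRange : ℕ → Part → Set
  InRange k p = 1 ≤ value p × value p ≤ k

  sumAlphabet-cong : ∀ {f g : Part → Carrier} k → (∀ p → InRange k p → f p ≈ g p) → sumAlphabet k f ≈ sumAlphabet k g
  sumAlphabet-cong zero    eq = refl
  sumAlphabet-cong (suc k) eq =
    +-cong (sumAlphabet-cong k (λ p (1≤p , p≤k) → eq p (1≤p , ℕ.m≤n⇒m≤1+n p≤k)))
           (sumList-cong colours (λ x → eq (suc k , x) (s≤s z≤n , ℕ.≤-refl)))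

  sumAlphabet-zero : ∀ {f : Part → Carrier} k → (∀ p → InRange k p → f p ≈ 0#) → sumAlphabet k f ≈ 0#
  sumAlphabet-zero zero    eq = refl
  sumAlphabet-zero (suc k) eq =
    trans (+-cong (sumAlphabet-zero k (λ p (1≤p , p≤k) → eq p (1≤p , ℕ.m≤n⇒m≤1+n p≤k)))
                  (sumList-zero colours (λ x → eq (suc k , x) (s≤s z≤n , ℕ.≤-refl))))
          (+-identityʳ 0#)

  sumAlphabet-+ : ∀ (f g : Part → Carrier) k → sumAlphabet k (λ p → f p + g p) ≈ sumAlphabet k f + sumAlphabet k g
  sumAlphabet-+ f g zero    = sym (+-identityʳ 0#)
  sumAlphabet-+ f g (suc k) = trans (+-cong (sumAlphabet-+ f g k) (sumList-+ (λ x → f (suc k , x)) (λ x → g (suc k , x)) colours))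
                                    (+-interchange (sumAlphabet k f) (sumAlphabet k g) (row f (suc k)) (row g (suc k)))

  sumAlphabet-sumTo : ∀ (f : Part → ℕ → Carrier) k n →
                      sumAlphabet k (λ p → sumTo (f p) n) ≈ sumTo (λ i → sumAlphabet k (λ p → f p i)) n
  sumAlphabet-sumTo f k zero    = refl
  sumAlphabet-sumTo f k (suc n) = trans (sumAlphabet-+ (λ p → sumTo (f p) n) (λ p → f p (suc n)) k)
                                        (+-congʳ (sumAlphabet-sumTo f k n))

  sumAlphabet-truncate : ∀ (f : Part → Carrier) {j k} → j ≤ k → (∀ p → j < value p → value p ≤ k → f p ≈ 0#) →
                         sumAlphabet k f ≈ sumAlphabet j f
  sumAlphabet-truncate f {j} {k} j≤k eq with ℕ.m≤n⇒m<n∨m≡n j≤k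
  ... | inj₂ ≡.refl = refl
  sumAlphabet-truncate f {j} {suc k} _ eq | inj₁ (s≤s j≤k) =
    trans (+-cong (sumAlphabet-truncate f j≤k (λ p j<p p≤k → eq p j<p (ℕ.m≤n⇒m≤1+n p≤k)))
                  (sumList-zero colours (λ x → eq (suc k , x) (s≤s j≤k) ℕ.≤-refl)))
          (+-identityʳ _)

-- Splitting off the largest part

-- pre is the part just before the list, if any.
Continues : Maybe Part → List Part → Set
Continues nothing  t = Linked Adj t
Continues (just x) t = Linked Adj (x ∷ t)

continues? : ∀ pre t → Dec (Continues pre t)
continues? nothing  t = linked? Adj? t
continues? (just x) t = linked? Adj? (x ∷ t)

CanFollow : Maybe Part → Part → Set
CanFollow nothing  y = ⊤
CanFollow (just x) y = Adj x y

canFollow? : ∀ pre y → Dec (CanFollow pre y)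
canFollow? nothing  y = yes tt
canFollow? (just x) y = Adj? x y

Counted : Maybe Part → ℕ → List Part → Set
Counted pre n t = Continues pre t × size t ≡ n

counted? : ∀ pre n t → Dec (Counted pre n t)
counted? pre n t = continues? pre t ×-dec (size t ℕ.≟ n)

counted-[] : ∀ pre → Counted pre 0 []
counted-[] nothing  = [] , ≡.refl
counted-[] (just x) = [-] , ≡.refl

counted-∷⁻ : ∀ pre n y t → Counted pre n (y ∷ t) → CanFollow pre y × value y ≤ n × Counted (just y) (n ∸ value y) t
counted-∷⁻ pre n y t (cont , ≡.refl) =
  canFollow pre cont , ℕ.m≤m+n (value y) (size t) , tail pre cont , ≡.sym (ℕ.m+n∸m≡n (value y) (size t))
  where
  canFollow : ∀ pre → Continues pre (y ∷ t) → CanFollow pre y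
  canFollow nothing  _    = tt
  canFollow (just x) cont = Linked.head cont
  tail : ∀ pre → Continues pre (y ∷ t) → Linked Adj (y ∷ t)
  tail nothing  cont = cont
  tail (just x) cont = Linked.tail cont

counted-∷⁺ : ∀ pre n y t → CanFollow pre y → value y ≤ n → Counted (just y) (n ∸ value y) t → Counted pre n (y ∷ t)
counted-∷⁺ pre n y t follows y≤n (cont , eq) = extend pre follows , ≡.trans (≡.cong (value y ℕ.+_) eq) (ℕ.m+[n∸m]≡n y≤n)
  where
  extend : ∀ pre → CanFollow pre y → Continues pre (y ∷ t)
  extend nothing  _   = cont
  extend (just x) adj = adj ∷ cont

module Partitions {r ℓ : Level} (F : Field r ℓ) (a b c d : Field.Carrier F) where
  open Field F hiding (zero)
  open Series F
  open Vars a b c d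
  open PowerSeries F
  open Sums F
  open import Relation.Binary.Reasoning.Setoid setoid

  sumLists : ℕ → ℕ → (List Part → Carrier) → Carrier
  sumLists k l h = sumList h (listsOfLength (alphabet k) l)

  sumLists-suc : ∀ k l (h : List Part → Carrier) →
                 sumLists k (suc l) h ≈ sumAlphabet k (λ y → sumLists k l (λ t → h (y ∷ t)))
  sumLists-suc k l h = begin
    sumList h (concatMap (λ y → map (y ∷_) (listsOfLength (alphabet k) l)) (alphabet k))
      ≈⟨ sumList-concatMap h (λ y → map (y ∷_) (listsOfLength (alphabet k) l)) (alphabet k) ⟩
    sumList (λ y → sumList h (map (y ∷_) (listsOfLength (alphabet k) l))) (alphabet k)
      ≈⟨ sumList-cong (alphabet k) (λ y → sumList-map h (y ∷_) (listsOfLength (alphabet k) l)) ⟩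
    sumList (λ y → sumLists k l (λ t → h (y ∷ t))) (alphabet k)
      ≈⟨ sumList-alphabet _ k ⟩
    sumAlphabet k (λ y → sumLists k l (λ t → h (y ∷ t))) ∎

  sumLists-cong : ∀ k l {h h′ : List Part → Carrier} → (∀ t → All (InRange k) t → h t ≈ h′ t) →
                  sumLists k l h ≈ sumLists k l h′
  sumLists-cong k zero    eq = +-congʳ (eq [] [])
  sumLists-cong k (suc l) {h} {h′} eq = begin
    sumLists k (suc l) h                                      ≈⟨ sumLists-suc k l h ⟩
    sumAlphabet k (λ y → sumLists k l (λ t → h (y ∷ t)))
      ≈⟨ sumAlphabet-cong k (λ y y∈ → sumLists-cong k l (λ t t∈ → eq (y ∷ t) (y∈ ∷ t∈))) ⟩
    sumAlphabet k (λ y → sumLists k l (λ t → h′ (y ∷ t)))     ≈⟨ sym (sumLists-suc k l h′) ⟩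
    sumLists k (suc l) h′                                     ∎

  withFirstPart : (Maybe Part → ℕ → Carrier) → Maybe Part → ℕ → Part → Carrier
  withFirstPart W pre n y = iverson (canFollow? pre y) (iverson (value y ℕ.≤? n) (var (proj₂ y) * W (just y) (n ∸ value y)))

  weightOfLength : ℕ → ℕ → Maybe Part → ℕ → Carrier
  weightOfLength k l pre n = sumLists k l (λ t → iverson (counted? pre n t) (weight t))

  weightOfLength-zero : ∀ k pre n → weightOfLength k 0 pre n ≈ const 1# n
  weightOfLength-zero k pre zero    = trans (+-identityʳ _) (iverson-yes (counted? pre 0 []) (counted-[] pre))
  weightOfLength-zero k pre (suc n) = trans (+-identityʳ _) (iverson-no (counted? pre (suc n) []) (λ ()))

  weightOfLength-suc : ∀ k l pre n → weightOfLength k (suc l) pre n ≈ sumAlphabet k (withFirstPart (weightOfLength k l) pre n)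
  weightOfLength-suc k l pre n =
    trans (sumLists-suc k l _) (sumAlphabet-cong k (λ y _ → first y (canFollow? pre y) (value y ℕ.≤? n)))
    where
    first : ∀ y (follows? : Dec (CanFollow pre y)) (fits? : Dec (value y ≤ n)) →
            sumLists k l (λ t → iverson (counted? pre n (y ∷ t)) (var (proj₂ y) * weight t)) ≈
            iverson follows? (iverson fits? (var (proj₂ y) * weightOfLength k l (just y) (n ∸ value y)))
    first y (yes follows) (yes fits) = begin
      sumLists k l (λ t → iverson (counted? pre n (y ∷ t)) (var (proj₂ y) * weight t))
        ≈⟨ sumLists-cong k l (λ t _ → iverson-⇔ (counted? pre n (y ∷ t)) (counted? (just y) (n ∸ value y) t)
                                         (λ cnt → proj₂ (proj₂ (counted-∷⁻ pre n y t cnt))) (counted-∷⁺ pre n y t follows fits)) ⟩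
      sumLists k l (λ t → iverson (counted? (just y) (n ∸ value y) t) (var (proj₂ y) * weight t))
        ≈⟨ sumLists-cong k l (λ t _ → sym (*-iverson (counted? (just y) (n ∸ value y) t) (var (proj₂ y)) (weight t))) ⟩
      sumLists k l (λ t → var (proj₂ y) * iverson (counted? (just y) (n ∸ value y) t) (weight t))
        ≈⟨ sym (*-distribˡ-sumList (var (proj₂ y)) _ (listsOfLength (alphabet k) l)) ⟩
      var (proj₂ y) * weightOfLength k l (just y) (n ∸ value y)  ∎
    first y (yes _) (no ¬fits) = sumList-zero (listsOfLength (alphabet k) l) (λ t →
      iverson-no (counted? pre n (y ∷ t)) (λ cnt → ¬fits (proj₁ (proj₂ (counted-∷⁻ pre n y t cnt)))))
    first y (no ¬follows) _ = sumList-zero (listsOfLength (alphabet k) l) (λ t →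
      iverson-no (counted? pre n (y ∷ t)) (λ cnt → ¬follows (proj₁ (counted-∷⁻ pre n y t cnt))))

  -- parts are positive, so a partition of n has at most n parts
  weightOfLength-long : ∀ k l pre n → n < l → weightOfLength k l pre n ≈ 0#
  weightOfLength-long k (suc l) pre n (s≤s n≤l) =
    trans (weightOfLength-suc k l pre n) (sumAlphabet-zero k (λ y y∈ → vanishes y y∈ (canFollow? pre y) (value y ℕ.≤? n)))
    where
    vanishes : ∀ y → InRange k y → (follows? : Dec (CanFollow pre y)) (fits? : Dec (value y ≤ n)) →
               iverson follows? (iverson fits? (var (proj₂ y) * weightOfLength k l (just y) (n ∸ value y))) ≈ 0#
    vanishes y _          follows? (no _)     = iverson-zero follows? refl
    vanishes y (1≤y , _)  follows? (yes fits) = iverson-zero follows?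
      (trans (*-congˡ (weightOfLength-long k l (just y) (n ∸ value y) (ℕ.<-≤-trans (ℕ.∸-monoʳ-< 1≤y fits) n≤l))) (zeroʳ _))

  totalWeight : ℕ → Maybe Part → ℕ → Carrier
  totalWeight k pre n = sumTo (λ l → weightOfLength k l pre n) n

  totalWeight-first-part : ∀ k pre n → totalWeight k pre n ≈ const 1# n + sumAlphabet k (withFirstPart (totalWeight k) pre n)
  totalWeight-first-part k pre zero = trans (weightOfLength-zero k pre 0)
    (sym (trans (+-congˡ (sumAlphabet-zero k (λ y (1≤y , _) →
                   iverson-zero (canFollow? pre y) (iverson-no (value y ℕ.≤? 0) (ℕ.<⇒≱ 1≤y)))))
                (+-identityʳ _)))
  totalWeight-first-part k pre (suc n) = begin
    sumTo (λ l → weightOfLength k l pre (suc n)) (suc n)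
      ≈⟨ sumTo-suc _ n ⟩
    weightOfLength k 0 pre (suc n) + sumTo (λ l → weightOfLength k (suc l) pre (suc n)) n
      ≈⟨ +-cong (weightOfLength-zero k pre (suc n)) (sumTo-cong n (λ l → weightOfLength-suc k l pre (suc n))) ⟩
    const 1# (suc n) + sumTo (λ l → sumAlphabet k (λ y → summand y l)) n
      ≈⟨ +-congˡ (sym (sumAlphabet-sumTo summand k n)) ⟩
    const 1# (suc n) + sumAlphabet k (λ y → sumTo (summand y) n)
      ≈⟨ +-congˡ (sumAlphabet-cong k (λ y y∈ → sum-lengths y y∈ (canFollow? pre y) (value y ℕ.≤? suc n))) ⟩
    const 1# (suc n) + sumAlphabet k (withFirstPart (totalWeight k) pre (suc n)) ∎
    where
    summand : Part → ℕ → Carrier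
    summand y l = withFirstPart (weightOfLength k l) pre (suc n) y
    sum-lengths : ∀ y → InRange k y → (follows? : Dec (CanFollow pre y)) (fits? : Dec (value y ≤ suc n)) →
      sumTo (λ l → iverson follows? (iverson fits? (var (proj₂ y) * weightOfLength k l (just y) (suc n ∸ value y)))) n ≈
      iverson follows? (iverson fits? (var (proj₂ y) * totalWeight k (just y) (suc n ∸ value y)))
    sum-lengths y _         (no _)  _       = sumTo-zero n (λ _ _ → refl)
    sum-lengths y _         (yes _) (no _)  = sumTo-zero n (λ _ _ → refl)
    sum-lengths y (1≤y , _) (yes _) (yes _) = trans (sym (*-distribˡ-sumTo _ _ n)) (*-congˡ
      (sumTo-truncate _ (ℕ.∸-monoʳ-≤ (suc n) 1≤y) (λ l long _ → weightOfLength-long k l (just y) (suc n ∸ value y) long)))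

  adj⇒≤ : ∀ p q → Adj p q → value q ≤ value p
  adj⇒≤ p q (inj₁ lt , _)      = ℕ.<⇒≤ lt
  adj⇒≤ p q (inj₂ (eq , _) , _) = ℕ.≤-reflexive eq

  -- parts after y never exceed y
  weightOfLength-bound : ∀ {j k} l y n → value y ≤ j → j ≤ k → weightOfLength k l (just y) n ≈ weightOfLength j l (just y) n
  weightOfLength-bound {j} {k} zero    y n _   _   = trans (weightOfLength-zero k (just y) n) (sym (weightOfLength-zero j (just y) n))
  weightOfLength-bound {j} {k} (suc l) y n y≤j j≤k = begin
    weightOfLength k (suc l) (just y) n  ≈⟨ weightOfLength-suc k l (just y) n ⟩
    sumAlphabet k (summand k)            ≈⟨ sumAlphabet-truncate (summand k) j≤k (λ p j<p _ →
                                              iverson-no (Adj? y p) (λ adj → ℕ.<⇒≱ j<p (ℕ.≤-trans (adj⇒≤ y p adj) y≤j))) ⟩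
    sumAlphabet j (summand k)            ≈⟨ sumAlphabet-cong j (λ p (_ , p≤j) → iverson-cong (Adj? y p) (iverson-cong (value p ℕ.≤? n)
                                              (*-congˡ (weightOfLength-bound l p (n ∸ value p) p≤j j≤k)))) ⟩
    sumAlphabet j (summand j)            ≈⟨ sym (weightOfLength-suc j l (just y) n) ⟩
    weightOfLength j (suc l) (just y) n  ∎
    where
    summand : ℕ → Part → Carrier
    summand k′ = withFirstPart (weightOfLength k′ l) (just y) n

  G≈totalWeight : ∀ k n → G k n ≈ totalWeight k nothing n
  G≈totalWeight k n = begin
    G k n
      ≈⟨ sumList-filter (GSet? k n) weight (candidates k n) ⟩
    sumList (λ t → iverson (GSet? k n t) (weight t)) (candidates k n)
      ≈⟨ sumList-concatMap _ (listsOfLength (alphabet k)) (upTo (suc n)) ⟩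
    sumList (λ l → sumLists k l (λ t → iverson (GSet? k n t) (weight t))) (upTo (suc n))
      ≈⟨ sumList-applyUpTo _ (λ l → l) n ⟩
    sumTo (λ l → sumLists k l (λ t → iverson (GSet? k n t) (weight t))) n
      ≈⟨ sumTo-cong n (λ l → sumLists-cong k l (λ t t∈ → iverson-⇔ (GSet? k n t) (counted? nothing n t)
                                                    (λ ((_ , linked) , _ , size≡n) → linked , size≡n)
                                                    (λ (linked , size≡n) → ((All.map proj₁ t∈ , linked) , All.map proj₂ t∈ , size≡n)))) ⟩
    totalWeight k nothing n ∎

  -- After y and Headed y are the generating functions of the partitions that may follow
  -- the part y, and of the partitions whose largest part is y.
  After : Part → PS
  After y = totalWeight (value y) (just y)

  Headed : Part → PS
  Headed y n = iverson (value y ℕ.≤? n) (var (proj₂ y) * After y (n ∸ value y))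

  totalWeight≈After : ∀ {k} y n → value y ≤ k → totalWeight k (just y) n ≈ After y n
  totalWeight≈After y n y≤k = sumTo-cong n (λ l → weightOfLength-bound l y n ℕ.≤-refl y≤k)

  G-first-part : ∀ k n → G k n ≈ const 1# n + sumAlphabet k (λ y → Headed y n)
  G-first-part k n = trans (G≈totalWeight k n) (trans (totalWeight-first-part k nothing n)
    (+-congˡ (sumAlphabet-cong k (λ y (_ , y≤k) →
      iverson-cong (value y ℕ.≤? n) (*-congˡ (totalWeight≈After y (n ∸ value y) y≤k))))))

  After-first-part : ∀ y n → After y n ≈ const 1# n + sumAlphabet (value y) (λ z → iverson (Adj? y z) (Headed z n))
  After-first-part y n = trans (totalWeight-first-part (value y) (just y) n)
    (+-congˡ (sumAlphabet-cong (value y) (λ z (_ , z≤y) → iverson-cong (Adj? y z) (iverson-cong (value z ℕ.≤? n)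
      (*-congˡ (totalWeight≈After z (n ∸ value z) z≤y))))))

  Pm≤2 : ∀ x y → Pm x y ≤ 2
  Pm≤2 ca ca = ℕ.≤-refl
  Pm≤2 ca cb = s≤s z≤n
  Pm≤2 ca cc = ℕ.≤-refl
  Pm≤2 ca cd = ℕ.≤-refl
  Pm≤2 cb ca = s≤s z≤n
  Pm≤2 cb cb = z≤n
  Pm≤2 cb cc = s≤s z≤n
  Pm≤2 cb cd = s≤s z≤n
  Pm≤2 cc ca = z≤n
  Pm≤2 cc cb = s≤s z≤n
  Pm≤2 cc cc = z≤n
  Pm≤2 cc cd = ℕ.≤-refl
  Pm≤2 cd ca = z≤n
  Pm≤2 cd cb = s≤s z≤n
  Pm≤2 cd cc = z≤n
  Pm≤2 cd cd = ℕ.≤-refl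

  adj-far : ∀ m x p → 2 ℕ.+ value p ≤ m → Adj (m , x) p
  adj-far m x (m′ , y) 2+m′≤m =
    inj₁ (ℕ.<-≤-trans (ℕ.m<n+m m′ (s≤s z≤n)) 2+m′≤m) , ℕ.≤-trans (ℕ.+-monoˡ-≤ m′ (Pm≤2 x y)) 2+m′≤m

  FollowsNext : Colour → Colour → Set
  FollowsNext x y = Pm x y ≤ 1

  followsNext? : ∀ x y → Dec (FollowsNext x y)
  followsNext? x y = Pm x y ℕ.≤? 1

  FollowsSame : Colour → Colour → Set
  FollowsSame x y = rank y ≤ rank x × Pm x y ≡ 0

  followsSame? : ∀ x y → Dec (FollowsSame x y)
  followsSame? x y = (rank y ℕ.≤? rank x) ×-dec (Pm x y ℕ.≟ 0)

  adj-next⇔ : ∀ j x y w → iverson (Adj? (suc (suc j) , x) (suc j , y)) w ≈ iverson (followsNext? x y) w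
  adj-next⇔ j x y w = iverson-⇔ (Adj? (suc (suc j) , x) (suc j , y)) (followsNext? x y)
    (λ (_ , le) → ℕ.+-cancelʳ-≤ (suc j) (Pm x y) 1 le)
    (λ le → inj₁ ℕ.≤-refl , ℕ.+-monoˡ-≤ (suc j) le)

  adj-same⇔ : ∀ m x y w → iverson (Adj? (m , x) (m , y)) w ≈ iverson (followsSame? x y) w
  adj-same⇔ m x y w = iverson-⇔ (Adj? (m , x) (m , y)) (followsSame? x y)
    (λ { (inj₁ m<m , _)            → contradiction m<m (ℕ.<-irrefl ≡.refl)
       ; (inj₂ (_ , y≤x) , le)     → y≤x , ℕ.n≤0⇒n≡0 (ℕ.+-cancelʳ-≤ m (Pm x y) 0 le) })
    (λ { (y≤x , eq) → inj₂ (≡.refl , y≤x) , ≡.subst (λ p → p ℕ.+ m ≤ m) (≡.sym eq) ℕ.≤-refl })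

  headedRow : List Colour → ℕ → PS
  headedRow ys m n = sumList (λ y → Headed (m , y) n) ys

  row-filter : ∀ {P : Colour → Set} (P? : ∀ y → Dec (P y)) m n {x} →
               (∀ y w → iverson (Adj? x (m , y)) w ≈ iverson (P? y) w) →
               row (λ y → iverson (Adj? x y) (Headed y n)) m ≈ headedRow (filter P? colours) m n
  row-filter P? m n adj⇔ = trans (sumList-cong colours (λ y → adj⇔ y (Headed (m , y) n)))
                                 (sym (sumList-filter P? (λ y → Headed (m , y) n) colours))

  After-one : ∀ x → After (1 , x) ≋ const 1# ⊕ headedRow (filter (followsSame? x) colours) 1
  After-one x n = trans (After-first-part (1 , x) n)
    (+-congˡ (trans (+-identityˡ _) (row-filter (followsSame? x) 1 n (adj-same⇔ 1 x))))

  After-suc-suc : ∀ j x → After (suc (suc j) , x) ≋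
                  G j ⊕ (headedRow (filter (followsNext? x) colours) (suc j)
                         ⊕ headedRow (filter (followsSame? x) colours) (suc (suc j)))
  After-suc-suc j x n = begin
    After (m , x) n                                                       ≈⟨ After-first-part (m , x) n ⟩
    const 1# n + ((sumAlphabet j summand + row summand (suc j)) + row summand m)
      ≈⟨ +-congˡ (+-cong (+-cong (sumAlphabet-cong j (λ y (_ , y≤j) → iverson-yes (Adj? (m , x) y) (adj-far m x y (s≤s (s≤s y≤j)))))
                                 (row-filter (followsNext? x) (suc j) n (adj-next⇔ j x)))
                         (row-filter (followsSame? x) m n (adj-same⇔ m x))) ⟩
    const 1# n + ((sumAlphabet j (λ y → Headed y n) + next) + same)      ≈⟨ sym (+-assoc _ _ _) ⟩
    const 1# n + (sumAlphabet j (λ y → Headed y n) + next) + same        ≈⟨ +-congʳ (sym (+-assoc _ _ _)) ⟩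
    (const 1# n + sumAlphabet j (λ y → Headed y n)) + next + same        ≈⟨ +-congʳ (+-congʳ (sym (G-first-part j n))) ⟩
    G j n + next + same                                                  ≈⟨ +-assoc _ _ _ ⟩
    G j n + (next + same)                                                ∎
    where
    m = suc (suc j)
    next = headedRow (filter (followsNext? x) colours) (suc j) n
    same = headedRow (filter (followsSame? x) colours) m n
    summand : Part → Carrier
    summand y = iverson (Adj? (m , x) y) (Headed y n)

  After-d≈After-c : ∀ m → After (suc m , cd) ≋ After (suc m , cc)
  After-d≈After-c zero    n = trans (After-one cd n) (sym (After-one cc n))
  After-d≈After-c (suc j) n = trans (After-suc-suc j cd n) (sym (After-suc-suc j cc n))

  G-suc : ∀ j → G (suc j) ≋ G j ⊕ (Headed (suc j , ca) ⊕ (Headed (suc j , cb) ⊕ (Headed (suc j , cc) ⊕ Headed (suc j , cd))))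
  G-suc j n = trans (G-first-part (suc j) n)
    (trans (sym (+-assoc _ _ _)) (+-cong (sym (G-first-part j n)) (+-congˡ (+-congˡ (+-congˡ (+-identityʳ _))))))

  G-zero : G 0 ≋ const 1#
  G-zero n = trans (G-first-part 0 n) (+-identityʳ _)

  Headed≋q^ : ∀ m x → Headed (m , x) ≋ q^ m ⊗ (const (var x) ⊗ After (m , x))
  Headed≋q^ m x n =
    trans (pointwise n) (trans (mulq≋q^⊗ m _ n) (⊗-congʳ (q^ m) (λ i → sym (const-⊗ (var x) (After (m , x)) i)) n))
    where
    pointwise : ∀ n → Headed (m , x) n ≈ mulq m (var x • After (m , x)) n
    pointwise n with m ℕ.≤? n
    ... | no m≰n  = sym (reflexive (mulq-< m _ (ℕ.≰⇒> m≰n)))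
    ... | yes m≤n = sym (reflexive (mulq-≥ m (var x • After (m , x)) m≤n))

  -- In the lemmas below the filtered lists of colours compute, e.g. to cb ∷ [] for ca.
  After-a-one : After (1 , ca) ≋ const 1#
  After-a-one n = trans (After-one ca n) (+-identityʳ _)

  After-a : ∀ j → After (suc (suc j) , ca) ≋ G j ⊕ Headed (suc j , cb)
  After-a j n = trans (After-suc-suc j ca n) (+-congˡ (trans (+-congʳ (+-identityʳ _)) (+-identityʳ _)))

  After-b : ∀ j → After (suc j , cb) ≋ G j ⊕ Headed (suc j , cb)
  After-b zero    n = trans (After-one cb n) (+-cong (sym (G-zero n)) (+-identityʳ _))
  After-b (suc j) n = begin
    After (suc (suc j) , cb) n                                        ≈⟨ After-suc-suc j cb n ⟩
    G j n + (row (λ y → Headed y n) (suc j) + (Headed (m , cb) n + 0#))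
      ≈⟨ +-congˡ (+-cong (+-congˡ (+-congˡ (+-congˡ (+-identityʳ _)))) (+-identityʳ _)) ⟩
    G j n + ((Ha + (Hb + (Hc + Hd))) + Headed (m , cb) n)            ≈⟨ sym (+-assoc _ _ _) ⟩
    G j n + (Ha + (Hb + (Hc + Hd))) + Headed (m , cb) n              ≈⟨ +-congʳ (sym (G-suc j n)) ⟩
    G (suc j) n + Headed (m , cb) n                                  ∎
    where
    m = suc (suc j)
    Ha = Headed (suc j , ca) n; Hb = Headed (suc j , cb) n; Hc = Headed (suc j , cc) n; Hd = Headed (suc j , cd) n

  After-c-one : After (1 , cc) ≋ const 1# ⊕ (Headed (1 , ca) ⊕ Headed (1 , cc))
  After-c-one n = trans (After-one cc n) (+-congˡ (+-congˡ (+-identityʳ _)))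

  After-c : ∀ j → After (suc (suc j) , cc) ≋
            G j ⊕ ((Headed (suc j , ca) ⊕ (Headed (suc j , cb) ⊕ Headed (suc j , cc)))
                   ⊕ (Headed (suc (suc j) , ca) ⊕ Headed (suc (suc j) , cc)))
  After-c j n = trans (After-suc-suc j cc n) (+-congˡ (+-cong (+-congˡ (+-congˡ (+-identityʳ _))) (+-congˡ (+-identityʳ _))))

-- Recurrences for the generating functions

module GeneratingFunctions {r ℓ : Level} (F : Field r ℓ) (a b c d : Field.Carrier F) where
  open Field F using (0#; 1#)
  open Series F
  open Vars a b c d
  open PowerSeries F
  open Partitions F a b c d
  open CommutativeRing powerSeriesRing using (refl; sym; trans; *-congˡ; +-congˡ)
  open IntegerSolver powerSeriesRing using (solve; _:+_; _:*_; :-_; _:-_; _:=_; :0; :1; linear-combination; ⟨_⟩; _·_)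

  cA cB cC cD : PS
  cA = const a
  cB = const b
  cC = const c
  cD = const d

  Ĝ : ℕ → PS
  Ĝ j = G j ⊗ inv1m b (suc j)

  Ĝ-geometric : ∀ j → Ĝ j ≋ G j ⊕ cB ⊗ q^ suc j ⊗ Ĝ j
  Ĝ-geometric j = linear-combination (G j · inv1m-geometric b j ∷ [])
    (solve 4 (λ g i b q → g :* i := (g :+ b :* q :* (g :* i)) :+ g :* (i :- (:1 :+ (b :* q) :* i)))
           refl (G j) (inv1m b (suc j)) cB (q^ suc j))

  Headed-b : ∀ j → Headed (suc j , cb) ≋ cB ⊗ q^ suc j ⊗ Ĝ j
  Headed-b j = linear-combination
    (I · Headed≋q^ (suc j) cb ∷ (I ⊗ q^ suc j ⊗ cB) · After-b j ∷ (⊖ Headed (suc j , cb)) · inv1m-geometric b j ∷ [])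
    (solve 6 (λ x y g i b q → x := b :* q :* (g :* i) :+
                 (i :* (x :- q :* (b :* y)) :+ ((i :* q :* b) :* (y :- (g :+ x)) :+ (:- x) :* (i :- (:1 :+ (b :* q) :* i)))))
           refl (Headed (suc j , cb)) (After (suc j , cb)) (G j) I cB (q^ suc j))
    where I = inv1m b (suc j)

  Ĝ≋G+Headed-b : ∀ j → Ĝ j ≋ G j ⊕ Headed (suc j , cb)
  Ĝ≋G+Headed-b j = trans (Ĝ-geometric j) (+-congˡ (sym (Headed-b j)))

  -- Ĝ′ j stands for Ĝ_{j-2}, matching the indexing of H′ (Ĝ_{-2} = 0, Ĝ_{-1} = 1).
  Ĝ′ : ℕ → PS
  Ĝ′ zero             = const 0#
  Ĝ′ (suc zero)       = const 1#
  Ĝ′ (suc (suc j))    = Ĝ j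

  After-a≋Ĝ′ : ∀ m → After (suc m , ca) ≋ Ĝ′ (suc m)
  After-a≋Ĝ′ zero    = After-a-one
  After-a≋Ĝ′ (suc j) = trans (After-a j) (sym (Ĝ≋G+Headed-b j))

  Aᶜ : ℕ → PS
  Aᶜ zero    = const 0#
  Aᶜ (suc m) = After (suc m , cc)

  Headed-a : ∀ m → Headed (suc m , ca) ≋ q^ suc m ⊗ (cA ⊗ Ĝ′ (suc m))
  Headed-a m = trans (Headed≋q^ (suc m) ca) (*-congˡ (*-congˡ (After-a≋Ĝ′ m)))

  Headed-c : ∀ m → Headed (suc m , cc) ≋ q^ suc m ⊗ (cC ⊗ Aᶜ (suc m))
  Headed-c m = Headed≋q^ (suc m) cc

  Headed-d : ∀ m → Headed (suc m , cd) ≋ q^ suc m ⊗ (cD ⊗ Aᶜ (suc m))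
  Headed-d m = trans (Headed≋q^ (suc m) cd) (*-congˡ (*-congˡ (After-d≈After-c m)))

  G-suc-gf : ∀ j → G (suc j) ≋ Ĝ j ⊕ q^ suc j ⊗ (cA ⊗ Ĝ′ (suc j)) ⊕ q^ suc j ⊗ ((cC ⊕ cD) ⊗ Aᶜ (suc j))
  G-suc-gf j = linear-combination
    (⟨ G-suc j ⟩ ∷ ⟨ sym (Ĝ≋G+Headed-b j) ⟩ ∷ ⟨ Headed-a j ⟩ ∷ ⟨ Headed-c j ⟩ ∷ ⟨ Headed-d j ⟩ ∷ [])
    (solve 13 (λ g₁ g ha hb hc hd ĝ ĝ′ t a c d q →
                 g₁ := ĝ :+ q :* (a :* ĝ′) :+ q :* ((c :+ d) :* t) :+
                       ((g₁ :- (g :+ (ha :+ (hb :+ (hc :+ hd))))) :+ (((g :+ hb) :- ĝ) :+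
                        ((ha :- q :* (a :* ĝ′)) :+ ((hc :- q :* (c :* t)) :+ (hd :- q :* (d :* t)))))))
           refl (G (suc j)) (G j) (Headed (suc j , ca)) (Headed (suc j , cb)) (Headed (suc j , cc)) (Headed (suc j , cd))
                (Ĝ j) (Ĝ′ (suc j)) (Aᶜ (suc j)) cA cC cD (q^ suc j))

  Ĝ-recurrence : ∀ m → Ĝ m ≋ Ĝ′ (suc m) ⊕ cA ⊗ q^ m ⊗ Ĝ′ m ⊕ (cC ⊕ cD) ⊗ q^ m ⊗ Aᶜ m ⊕ cB ⊗ q^ suc m ⊗ Ĝ m
  Ĝ-recurrence zero = linear-combination (⟨ Ĝ-geometric 0 ⟩ ∷ ⟨ G-zero ⟩ ∷ [])
    (solve 8 (λ ĝ g a b c d q₀ q₁ → ĝ := :1 :+ a :* q₀ :* :0 :+ (c :+ d) :* q₀ :* :0 :+ b :* q₁ :* ĝ :+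
                                          ((ĝ :- (g :+ b :* q₁ :* ĝ)) :+ (g :- :1)))
           refl (Ĝ 0) (G 0) cA cB cC cD (q^ 0) (q^ 1))
  Ĝ-recurrence (suc j) = linear-combination (⟨ Ĝ-geometric (suc j) ⟩ ∷ ⟨ G-suc-gf j ⟩ ∷ [])
    (solve 11 (λ ĝ₁ g₁ ĝ ĝ′ t a b c d q q′ → ĝ₁ := ĝ :+ a :* q :* ĝ′ :+ (c :+ d) :* q :* t :+ b :* q′ :* ĝ₁ :+
                                              ((ĝ₁ :- (g₁ :+ b :* q′ :* ĝ₁)) :+ (g₁ :- (ĝ :+ q :* (a :* ĝ′) :+ q :* ((c :+ d) :* t)))))
           refl (Ĝ (suc j)) (G (suc j)) (Ĝ j) (Ĝ′ (suc j)) (Aᶜ (suc j)) cA cB cC cD (q^ suc j) (q^ suc (suc j)))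

  Aᶜ-recurrence : ∀ m → Aᶜ (suc m) ⊕ cD ⊗ q^ m ⊗ Aᶜ m ≋
                        G m ⊕ cA ⊗ q^ suc m ⊗ Ĝ′ (suc m) ⊕ cC ⊗ q^ suc m ⊗ Aᶜ (suc m)
  Aᶜ-recurrence zero = linear-combination (⟨ After-c-one ⟩ ∷ ⟨ sym G-zero ⟩ ∷ ⟨ Headed-a 0 ⟩ ∷ ⟨ Headed-c 0 ⟩ ∷ [])
    (solve 9 (λ t g ha hc a c d q₀ q₁ → t :+ d :* q₀ :* :0 := g :+ a :* q₁ :* :1 :+ c :* q₁ :* t :+
                                         ((t :- (:1 :+ (ha :+ hc))) :+ ((:1 :- g) :+ ((ha :- q₁ :* (a :* :1)) :+ (hc :- q₁ :* (c :* t))))))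
           refl (Aᶜ 1) (G 0) (Headed (1 , ca)) (Headed (1 , cc)) cA cC cD (q^ 0) (q^ 1))
  Aᶜ-recurrence (suc j) =
    linear-combination (⟨ After-c j ⟩ ∷ ⟨ sym (G-suc j) ⟩ ∷ ⟨ sym (Headed-d j) ⟩ ∷
                        ⟨ Headed-a (suc j) ⟩ ∷ ⟨ Headed-c (suc j) ⟩ ∷ [])
    (solve 16 (λ t₂ t₁ g₁ g ha hb hc hd ha′ hc′ ĝ a c d q q′ →
                 t₂ :+ d :* q :* t₁ := g₁ :+ a :* q′ :* ĝ :+ c :* q′ :* t₂ :+
                   ((t₂ :- (g :+ ((ha :+ (hb :+ hc)) :+ (ha′ :+ hc′)))) :+
                    (((g :+ (ha :+ (hb :+ (hc :+ hd)))) :- g₁) :+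
                     ((q :* (d :* t₁) :- hd) :+ ((ha′ :- q′ :* (a :* ĝ)) :+ (hc′ :- q′ :* (c :* t₂)))))))
           refl (Aᶜ (suc (suc j))) (Aᶜ (suc j)) (G (suc j)) (G j)
                (Headed (suc j , ca)) (Headed (suc j , cb)) (Headed (suc j , cc)) (Headed (suc j , cd))
                (Headed (suc (suc j) , ca)) (Headed (suc (suc j) , cc)) (Ĝ′ (suc (suc j))) cA cC cD (q^ suc j) (q^ suc (suc j)))

  -- Eliminating Aᶜ between the recurrences of Ĝ and Aᶜ.
  Ĝ-three-term : ∀ k → (const 1# ⊕ ⊖ (cC ⊗ q^ suc k)) ⊗ (const 1# ⊕ ⊖ (cB ⊗ q^ suc (suc k))) ⊗ Ĝ (suc k) ≋
                       (const 1# ⊕ ⊖ (cB ⊗ cC ⊗ q^ suc k ⊗ q^ suc k)) ⊗ Ĝ k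
                       ⊕ ((cA ⊕ cD) ⊗ q^ suc k ⊕ cA ⊗ cD ⊗ q^ suc k ⊗ q^ suc k) ⊗ Ĝ′ (suc k)
                       ⊕ cA ⊗ cD ⊗ q^ suc k ⊗ q^ k ⊗ Ĝ′ k
  Ĝ-three-term k = linear-combination
    ((const 1# ⊕ ⊖ (cC ⊗ x)) · Ĝ-recurrence (suc k) ∷ ((cC ⊕ cD) ⊗ x) · Aᶜ-recurrence k ∷
     (cD ⊗ x) · Ĝ-recurrence k ∷ ((cC ⊕ cD) ⊗ x) · sym (Ĝ-geometric k) ∷ [])
    (solve 14 (λ ĝ₁ ĝ ĝ′₁ ĝ′ t₁ t g a b c d x w y →
        (:1 :- c :* x) :* (:1 :- b :* w) :* ĝ₁ :=
        (:1 :- b :* c :* x :* x) :* ĝ :+ ((a :+ d) :* x :+ a :* d :* x :* x) :* ĝ′₁ :+ a :* d :* x :* y :* ĝ′ :+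
        ((:1 :- c :* x) :* (ĝ₁ :- (ĝ :+ a :* x :* ĝ′₁ :+ (c :+ d) :* x :* t₁ :+ b :* w :* ĝ₁)) :+
         (((c :+ d) :* x) :* ((t₁ :+ d :* y :* t) :- (g :+ a :* x :* ĝ′₁ :+ c :* x :* t₁)) :+
          ((d :* x) :* (ĝ :- (ĝ′₁ :+ a :* y :* ĝ′ :+ (c :+ d) :* y :* t :+ b :* x :* ĝ)) :+
           ((c :+ d) :* x) :* ((g :+ b :* x :* ĝ) :- ĝ)))))
      refl (Ĝ (suc k)) (Ĝ k) (Ĝ′ (suc k)) (Ĝ′ k) (Aᶜ (suc k)) (Aᶜ k) (G k) cA cB cC cD x (q^ suc (suc k)) (q^ k))
    where x = q^ suc k

-- Comparison with H

module InitialValue {r ℓ : Level} (F : Field r ℓ) (a b c d : Field.Carrier F)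
  (a≉0 : ¬ (Field._≈_ F a (Field.0# F))) (d≉0 : ¬ (Field._≈_ F d (Field.0# F))) where
  open Field F
  open IntegerSolver commutativeRing

  -- This is where H_{-3} = (b − 1) c q / (a d) comes from: it makes H_0 = G_0 / (1 − b q).
  initial-coefficient : (1# - b * c) + a * d * ((b - 1#) * c * inv a a≉0 * inv d d≉0) ≈ 1# - c
  initial-coefficient = linear-combination ((b - 1#) * c * (d * inv d d≉0) · inv-law a a≉0 ∷ (b - 1#) * c · inv-law d d≉0 ∷ [])
    (solve 6 (λ a b c d a⁻¹ d⁻¹ → (:1 :- b :* c) :+ a :* d :* ((b :- :1) :* c :* a⁻¹ :* d⁻¹) :=
                                   (:1 :- c) :+ (((b :- :1) :* c :* (d :* d⁻¹)) :* (a :* a⁻¹ :- :1) :+ ((b :- :1) :* c) :* (d :* d⁻¹ :- :1)))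
           refl a b c d (inv a a≉0) (inv d d≉0))

module Recurrence {r ℓ : Level} (F : Field r ℓ) (a b c d : Field.Carrier F)
  (a≉0 : ¬ (Field._≈_ F a (Field.0# F))) (d≉0 : ¬ (Field._≈_ F d (Field.0# F)))
  (1-c≉0 : ¬ (Field._≈_ F (Field._-_ F (Field.1# F) c) (Field.0# F))) where
  open Field F using (_≈_; _+_; _*_; -_; _-_; 1#; inv; inv-law)
  open Series F
  open Vars a b c d
  open HDef a≉0 d≉0 1-c≉0
  open PowerSeries F
  open Partitions F a b c d using (G-zero)
  open GeneratingFunctions F a b c d
  open InitialValue F a b c d a≉0 d≉0 using (initial-coefficient)
  open CommutativeRing powerSeriesRing using (refl; sym; trans; +-cong; +-congˡ; *-cong; *-assoc; -‿cong)
  open IntegerSolver powerSeriesRing using (solve; _:+_; _:*_; :-_; _:-_; _:=_; :0; :1; linear-combination; ⟨_⟩; _·_)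

  H₀≋Ĝ₀ : H′ 3 ≋ Ĝ 0
  H₀≋Ĝ₀ = linear-combination ((const c⁻ ⊗ inv1m b 1) · Z₀≋1-c ∷ inv1m b 1 · sym (const-* c⁻ (1# - c)) ∷
                               inv1m b 1 · const-cong c⁻-inverse ∷ inv1m b 1 · sym G-zero ∷ [])
    (solve 6 (λ i⁻ ib z e f g₀ → i⁻ :* ib :* z := g₀ :* ib :+
                                   ((i⁻ :* ib) :* (z :- e) :+ (ib :* (i⁻ :* e :- f) :+ (ib :* (f :- :1) :+ ib :* (:1 :- g₀)))))
           refl (const c⁻) (inv1m b 1) Z₀ (const (1# - c)) (const (c⁻ * (1# - c))) (G 0))
    where
    K = (b - 1#) * c * inv a a≉0 * inv d d≉0
    c⁻ = inv (1# - c) 1-c≉0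
    Z₀ = const (1# - b * c) ⊗ H′ 2 ⊕ const (a + d + a * d) ⊗ H′ 1 ⊕ const (a * d) ⊗ divq (H′ 0)
    c⁻-inverse : c⁻ * (1# - c) ≈ 1#
    c⁻-inverse = Field.trans F (Field.*-comm F c⁻ (1# - c)) (inv-law (1# - c) 1-c≉0)
    Z₀≋1-c : Z₀ ≋ const (1# - c)
    Z₀≋1-c = linear-combination
      (⟨ sym (const-* (a * d) K) ⟩ ∷ ⟨ sym (const-+ (1# - b * c) (a * d * K)) ⟩ ∷ ⟨ const-cong initial-coefficient ⟩ ∷ [])
      (solve 7 (λ x y z k w s t → x :* :1 :+ y :* :0 :+ z :* k := t :+ ((z :* k :- w) :+ ((x :+ w :- s) :+ (s :- t))))
             refl (const (1# - b * c)) (const (a + d + a * d)) (const (a * d)) (const K) (const (a * d * K))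
                  (const ((1# - b * c) + a * d * K)) (const (1# - c)))

  H-step : ∀ k → H′ (3 ℕ.+ k) ≋ Ĝ k → H′ (2 ℕ.+ k) ≋ Ĝ′ (suc k) → H′ (suc k) ≋ Ĝ′ k →
           H′ (4 ℕ.+ k) ≋ Ĝ (suc k)
  H-step k ih₃ ih₂ ih₁ = linear-combination
    ((Ic ⊗ Ib) · Z≋R ∷ (Ic ⊗ Ib) · sym (Ĝ-three-term k) ∷
     (Ib ⊗ (const 1# ⊕ ⊖ (cB ⊗ w)) ⊗ Ĝ (suc k)) · inv1m-inverse c k ∷ Ĝ (suc k) · inv1m-inverse b (suc k) ∷ [])
    (solve 9 (λ ic ib z r ĝ c b x w → ic :* ib :* z := ĝ :+
                 ((ic :* ib) :* (z :- r) :+ ((ic :* ib) :* (r :- (:1 :- c :* x) :* (:1 :- b :* w) :* ĝ) :+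
                  ((ib :* (:1 :- b :* w) :* ĝ) :* (ic :* (:1 :- c :* x) :- :1) :+ ĝ :* (ib :* (:1 :- b :* w) :- :1)))))
           refl Ic Ib Z R (Ĝ (suc k)) cC cB x w)
    where
    x = q^ suc k
    w = q^ suc (suc k)
    Ic = inv1m c (suc k)
    Ib = inv1m b (suc (suc k))
    Z : PS
    Z = (const 1# ⊕ mulq (2 ℕ.* suc k) (const (- (b * c)))) ⊗ H′ (3 ℕ.+ k)
      ⊕ (mulq (suc k) (const (a + d)) ⊕ mulq (2 ℕ.* suc k) (const (a * d))) ⊗ H′ (2 ℕ.+ k)
      ⊕ mulq (2 ℕ.* suc k ∸ 1) (const (a * d)) ⊗ H′ (suc k)
    R : PS
    R = (const 1# ⊕ ⊖ (cB ⊗ cC ⊗ x ⊗ x)) ⊗ Ĝ k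
      ⊕ ((cA ⊕ cD) ⊗ x ⊕ cA ⊗ cD ⊗ x ⊗ x) ⊗ Ĝ′ (suc k)
      ⊕ cA ⊗ cD ⊗ x ⊗ q^ k ⊗ Ĝ′ k
    bc-term : mulq (2 ℕ.* suc k) (const (- (b * c))) ≋ ⊖ (cB ⊗ cC ⊗ x ⊗ x)
    bc-term = trans (mulq-const (2 ℕ.* suc k) (- (b * c)))
      (trans (*-cong (trans (const-neg (b * c)) (-‿cong (const-* b c))) (q^-double (suc k)))
             (solve 2 (λ y x → (:- y) :* (x :* x) := :- (y :* x :* x)) refl (cB ⊗ cC) x))
    ad-term : mulq (2 ℕ.* suc k) (const (a * d)) ≋ cA ⊗ cD ⊗ x ⊗ x
    ad-term = trans (mulq-const (2 ℕ.* suc k) (a * d))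
                    (trans (*-cong (const-* a d) (q^-double (suc k))) (sym (*-assoc (cA ⊗ cD) x x)))
    ad-term′ : mulq (2 ℕ.* suc k ∸ 1) (const (a * d)) ≋ cA ⊗ cD ⊗ x ⊗ q^ k
    ad-term′ = trans (mulq-const (2 ℕ.* suc k ∸ 1) (a * d))
                     (trans (*-cong (const-* a d) (q^-double-pred k)) (sym (*-assoc (cA ⊗ cD) x (q^ k))))
    Z≋R : Z ≋ R
    Z≋R = +-cong (+-cong (*-cong (+-congˡ bc-term) ih₃)
                             (*-cong (+-cong (trans (mulq-const (suc k) (a + d)) (⊗-congˡ x (const-+ a d))) ad-term) ih₂))
                     (*-cong ad-term′ ih₁)

  H′≋Ĝ′ : ∀ j → H′ (suc j) ≋ Ĝ′ j
  H′≋Ĝ′ zero                = refl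
  H′≋Ĝ′ (suc zero)          = refl
  H′≋Ĝ′ (suc (suc zero))    = H₀≋Ĝ₀
  H′≋Ĝ′ (suc (suc (suc k))) = H-step k (H′≋Ĝ′ (suc (suc k))) (H′≋Ĝ′ (suc k)) (H′≋Ĝ′ k)

lemma2p4 : ∀ {c ℓ : Level} (F : Field c ℓ) →
    (a b c d : Field.Carrier F) →
    (a≉0 : ¬ (Field._≈_ F a (Field.0# F))) →
    (d≉0 : ¬ (Field._≈_ F d (Field.0# F))) →
    (1-c≉0 : ¬ (Field._≈_ F (Field._-_ F (Field.1# F) c) (Field.0# F))) →
    (k n : ℕ) →
    Field._≈_ F
      (Series._⊗_ F (Series.Vars.G F a b c d k) (Series.inv1m F b (suc k)) n)
      (Series.Vars.HDef.H F a b c d a≉0 d≉0 1-c≉0 k n)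
lemma2p4 F a b c d a≉0 d≉0 1-c≉0 k n = Field.sym F (Recurrence.H′≋Ĝ′ F a b c d a≉0 d≉0 1-c≉0 (suc (suc k)) n)
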